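{- Let $R$ be a left-reduced ground rewrite system contained in $\succ$, and let $\succ\!\!\succ_R$ be the non-Horn $R$-normalization closure ordering. Let $\iota$ be a ground Parallel Superposition inference, either of type I $$\frac{(D'\lor t\approx t'\cdot\theta)\qquad(C[u,\dots,u]_{p_1,\dots,p_k}\cdot\theta)}{((D'\lor C[t',\dots,t']_{p_1,\dots,p_k})\sigma\cdot\theta)}$$ with $t\theta=u\theta$ and $\sigma=\mathrm{mgu}(t\doteq u)$, or of type II $$\frac{(D'\lor t\approx t'\cdot\theta)\qquad(C\cdot\theta)}{(D'\lor C\cdot\theta[x\mapsto u[t'\theta]])}$$ with $x\theta=u[t\theta]$. If $(D'\lor t\approx t'\cdot\theta)\prec\!\!\prec_R(C\cdot\theta)$ and $(t\theta\to t'\theta)\in R$, then $\mathrm{concl}(\iota)$ is $\succ\!\!\succ_R$-smaller than the premise $(C\cdot\theta)$.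
   Context: $\succ$ is a reduction ordering on terms, total on ground terms. Clauses are finite multisets of literals $s\approx t$, $s\not\approx t$ ($\approx$ symmetric). $\succ_L$ maps $s\approx t$ to $\{s,t\}$ and $s\not\approx t$ to $\{s,s,t,t\}$, compared via the multiset extension of $\succ$; $\succ_C$ is the multiset extension of $\succ_L$. Maximal / strictly maximal literal: no other literal of the clause larger / larger-or-equal. Most general unifiers are idempotent. A ground closure $(C\cdot\theta)$: clause $C$ and substitution $\theta$, $C\theta$ ground; identified up to bijective renaming of $C$ when instances coincide. $R$ contained in $\succ$: $u\succ v$ for all rules; left-reduced: no left-hand side reducible by the other rules; $t{\downarrow}_R$ normal form. Ground rules (premises variable-disjoint, one $\theta$). Parallel Superposition I: as displayed, where $u$ is not a variable; $t\theta=u\theta$; $\sigma=\mathrm{mgu}(t\doteq u)$; $p_1,\dots,p_k$ are all occurrences of $u$ in $C$; if an occurrence of $u$ is in a negative literal or below the top in a positive literal then $(D'\lor t\approx t')\theta\prec_CC\theta$; one occurrence of $u$ is in a positive literal $s[u]\approx s'$ with $(s[u]\approx s')\theta$ strictly maximal in $C\theta$ or in a negative literal $s[u]\not\approx s'$ with $(s[u]\not\approx s')\theta$ maximal in $C\theta$; $s[u]\theta\succ s'\theta$; $(t\approx t')\theta$ strictly maximal in $(D'\lor t\approx t')\theta$; $t\theta\succ t'\theta$. Parallel Superposition II: as displayed, where $x$ is a variable of $C$ with $x\theta=u[t\theta]$ ($t\theta$ occurs in $x\theta$ and is replaced there by $t'\theta$), with the same remaining conditions with $x$ in place of $u$. Non-Horn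 ordering: $\mathrm{ss}^-(C)$ set of all subterms (including top) of sides of negative literals of $C$; $\mathrm{ts}^-(C)$ set of sides of negative literals. $\mathrm{rm}_R(t)=\emptyset$ if $t$ is $R$-irreducible, $\mathrm{rm}_R(t)=\{\{u,u\}\}\cup\mathrm{rm}_R(t')$ if $t\to_Rt'$ using $u\to v\in R$. $\mathrm{nm}_R(C\cdot\theta)=\bigcup_{f(t_1,\dots,t_n)\in\mathrm{ss}^-(C)}\mathrm{rm}_R(f(t_1\theta{\downarrow}_R,\dots,t_n\theta{\downarrow}_R))\cup\bigcup_{x\in\mathrm{ss}^-(C),x\text{ variable}}\mathrm{rm}_R(x\theta)\cup\bigcup_{t\in\mathrm{ts}^-(C)}\{\{t\theta{\downarrow}_R,t\theta{\downarrow}_R\}\}\cup\bigcup_{(s\approx s')\in C}\{\{s\theta,s'\theta\}\}$ (multiset unions; last union over positive literals of $C$). Fix a well-founded $\succ_{Clo}$ on ground closures, total on closures with equal ground instance, with $(C\cdot\theta_1)\succ_{Clo}(D\cdot\theta_2)$ whenever $C\theta_1=D\theta_2$ and $D$ is an instance of $C$ but not vice versa. $\succ\!\!\succ_R$: lexicographic combination of (1) $(\succ_{mul})_{mul}$ on $\mathrm{nm}_R$, (2) $\succ_C$ on ground instances, (3) $\succ_{Clo}$; $\prec\!\!\prec_R$ converse. -}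

module Defs where

open import Data.Nat.Base using (ℕ; _≡ᵇ_)
open import Data.Bool.Base using (true; false)
open import Data.Fin.Base using (Fin)
open import Data.Vec.Base using (Vec; lookup; _[_]≔_)
import Data.Vec.Base as Vec
import Data.Vec.Relation.Binary.Pointwise.Inductive as VecPW
open import Data.List.Base using (List; []; _∷_; _++_; concat)
open import Data.List.Membership.Propositional using (_∈_)
open import Data.List.Relation.Unary.All using (All)
open import Data.List.Relation.Unary.Any using (Any)
open import Data.List.Relation.Unary.Unique.Propositional using (Unique)
open import Data.List.Relation.Binary.Pointwise using (Pointwise)
open import Data.List.Relation.Binary.Permutation.Homogeneous using (Permutation)
open import Data.Product using (Σ; ∃; ∃-syntax; _×_; _,_)
open import Data.Sum using (_⊎_)
open import Data.Empty using (⊥)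
open import Relation.Nullary using (¬_)
open import Relation.Binary.PropositionalEquality using (_≡_; _≢_)
open import Relation.Binary.Core using (Rel)
open import Induction.WellFounded using (WellFounded)
open import Function.Base using (flip)

MulExt : {A : Set} → Rel A Agda.Primitive.lzero → Rel A Agda.Primitive.lzero → Rel (List A) Agda.Primitive.lzero
MulExt {A} _≈_ _>_ M N =
  Σ (List A) λ Z → Σ (List A) λ X → Σ (List A) λ Y →
    Permutation _≈_ M (Z ++ X) × Permutation _≈_ N (Z ++ Y) ×
    (X ≢ []) × All (λ y → Any (λ x → x > y) X) Y

Enumerates : {A : Set} → (A → Set) → List A → Set
Enumerates {A} P S = Unique S × (∀ s → s ∈ S → P s) × (∀ s → P s → s ∈ S)

record Signature : Set₁ where
  field
    Fun   : Set
    arity : Fun → ℕ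

module Fol (Sig : Signature) where
  open Signature Sig

  data Term : Set where
    var : ℕ → Term
    fun : (f : Fun) → Vec Term (arity f) → Term

  Subst : Set
  Subst = ℕ → Term

  mutual
    sub : Subst → Term → Term
    sub θ (var x)    = θ x
    sub θ (fun f ts) = fun f (subs θ ts)

    subs : ∀ {n} → Subst → Vec Term n → Vec Term n
    subs θ Vec.[]       = Vec.[]
    subs θ (t Vec.∷ ts) = sub θ t Vec.∷ subs θ ts

  update : Subst → ℕ → Term → Subst
  update θ x r y with x ≡ᵇ y
  ... | true  = r
  ... | false = θ y

  data Subterm (s : Term) : Term → Set where
    top : Subterm s s
    arg : ∀ {f ts} (i : Fin (arity f)) → Subterm s (lookup ts i) → Subterm s (fun f ts)

  data ProperSubterm (s : Term) : Term → Set where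
    arg : ∀ {f ts} (i : Fin (arity f)) → Subterm s (lookup ts i) → ProperSubterm s (fun f ts)

  VarOf : ℕ → Term → Set
  VarOf x t = Subterm (var x) t

  Ground : Term → Set
  Ground t = ∀ x → ¬ VarOf x t

  IsVar : Term → Set
  IsVar t = ∃[ x ] (t ≡ var x)

  data Repl1 (a b : Term) : Term → Term → Set where
    here   : Repl1 a b a b
    inside : ∀ {f ts r} (i : Fin (arity f)) → Repl1 a b (lookup ts i) r →
             Repl1 a b (fun f ts) (fun f (ts [ i ]≔ r))

  mutual
    data ReplAll (a b : Term) : Term → Term → Set where
      hit  : ReplAll a b a b
      varR : ∀ {x} → var x ≢ a → ReplAll a b (var x) (var x)
      funR : ∀ {f ts ts'} → fun f ts ≢ a → ReplAlls a b ts ts' →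
             ReplAll a b (fun f ts) (fun f ts')

    data ReplAlls (a b : Term) : ∀ {n} → Vec Term n → Vec Term n → Set where
      []  : ReplAlls a b Vec.[] Vec.[]
      _∷_ : ∀ {n s s'} {ts ts' : Vec Term n} → ReplAll a b s s' → ReplAlls a b ts ts' →
            ReplAlls a b (s Vec.∷ ts) (s' Vec.∷ ts')

  IsMGU : Subst → Term → Term → Set
  IsMGU σ t u =
    (sub σ t ≡ sub σ u) ×
    (∀ (ρ : Subst) → sub ρ t ≡ sub ρ u → Σ Subst λ τ → ∀ x → ρ x ≡ sub τ (σ x)) ×
    (∀ x → sub σ (σ x) ≡ σ x)

  data Literal : Set where
    pos : Term → Term → Literal
    neg : Term → Term → Literal

  Clause : Set
  Clause = List Literal   -- a finite multiset of literals

  subL : Subst → Literal → Literal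
  subL θ (pos s t) = pos (sub θ s) (sub θ t)
  subL θ (neg s t) = neg (sub θ s) (sub θ t)

  subC : Subst → Clause → Clause
  subC θ = Data.List.Base.map (subL θ)

  -- the multiset a literal is mapped to by ≻_L
  img : Literal → List Term
  img (pos s t) = s ∷ t ∷ []
  img (neg s t) = s ∷ s ∷ t ∷ t ∷ []

  -- literal identity (≈ is symmetric): same image multiset
  _≈L_ : Literal → Literal → Set
  L ≈L L' = Permutation _≡_ (img L) (img L')

  _≈C_ : Clause → Clause → Set
  _≈C_ = Permutation _≈L_

  VarOfL : ℕ → Literal → Set
  VarOfL x (pos s t) = VarOf x s ⊎ VarOf x t
  VarOfL x (neg s t) = VarOf x s ⊎ VarOf x t

  VarOfC : ℕ → Clause → Set
  VarOfC x C = Any (VarOfL x) C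

  GroundC : Clause → Set
  GroundC C = ∀ x → ¬ VarOfC x C

  ReplAllL : Term → Term → Literal → Literal → Set
  ReplAllL a b (pos s t) (pos s' t') = ReplAll a b s s' × ReplAll a b t t'
  ReplAllL a b (neg s t) (neg s' t') = ReplAll a b s s' × ReplAll a b t t'
  ReplAllL a b _ _ = ⊥

  -- C' = C[b,…,b] where all occurrences of a in C were replaced by b
  ReplAllC : Term → Term → Clause → Clause → Set
  ReplAllC a b = Pointwise (ReplAllL a b)

  module Orders (_≻_ : Term → Term → Set) where

    _≻L_ : Literal → Literal → Set
    L ≻L L' = MulExt _≡_ _≻_ (img L) (img L')

    _≻C_ : Clause → Clause → Set
    _≻C_ = MulExt _≈L_ _≻L_

    -- literal Lθ is maximal / strictly maximal in Cθ, where C = L + rest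
    MaxRest : Subst → Literal → Clause → Set
    MaxRest θ L rest = All (λ L' → ¬ (subL θ L' ≻L subL θ L)) rest

    StrictMaxRest : Subst → Literal → Clause → Set
    StrictMaxRest θ L rest =
      All (λ L' → ¬ (subL θ L' ≻L subL θ L) × ¬ (subL θ L' ≈L subL θ L)) rest

  record IsReductionOrdering (_≻_ : Term → Term → Set) : Set where
    field
      irrefl  : ∀ {s} → ¬ (s ≻ s)
      trans   : ∀ {s t r} → s ≻ t → t ≻ r → s ≻ r
      wf      : WellFounded (flip _≻_)
      stable  : ∀ {s t} (σ : Subst) → s ≻ t → sub σ s ≻ sub σ t
      monotone : ∀ {s t c c'} → s ≻ t → Repl1 s t c c' → c ≻ c'

  TotalOnGround : (Term → Term → Set) → Set
  TotalOnGround _≻_ = ∀ {s t} → Ground s → Ground t → s ≡ t ⊎ s ≻ t ⊎ t ≻ s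

  module Rewriting (R : Term → Term → Set) where

    GroundRS : Set
    GroundRS = ∀ {u v} → R u v → Ground u × Ground v

    ContainedIn : (Term → Term → Set) → Set
    ContainedIn _≻_ = ∀ {u v} → R u v → u ≻ v

    LeftReduced : Set
    LeftReduced = ∀ {u v u' v'} → R u v → R u' v' → ¬ (u ≡ u' × v ≡ v') → ¬ Subterm u' u

    Irreducible : Term → Set
    Irreducible t = ∀ {u v s} → R u v → ¬ Repl1 u v t s

    -- RM t n M : t reduces to the normal form n, and M = rm_R(t)
    -- (each step with rule u → v contributes {u,u})
    data RM : Term → Term → List (List Term) → Set where
      done : ∀ {t} → Irreducible t → RM t t []
      step : ∀ {t t' n u v M} → R u v → Repl1 u v t t' → RM t' n M →
             RM t n ((u ∷ u ∷ []) ∷ M)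

    NF : Term → Term → Set
    NF t n = ∃[ M ] RM t n M

    InSS : Clause → Term → Set
    InSS C s = ∃[ a ] ∃[ b ] (neg a b ∈ C × (Subterm s a ⊎ Subterm s b))

    InTS : Clause → Term → Set
    InTS C s = ∃[ a ] ∃[ b ] (neg a b ∈ C × (s ≡ a ⊎ s ≡ b))

    data SSContrib (θ : Subst) : Term → List (List Term) → Set where
      cvar : ∀ {x n M} → RM (θ x) n M → SSContrib θ (var x) M
      cfun : ∀ {f ts ns n M} → VecPW.Pointwise (λ a m → NF (sub θ a) m) ts ns →
             RM (fun f ns) n M → SSContrib θ (fun f ts) M

    TSContrib : Subst → Term → List Term → Set
    TSContrib θ t m = ∃[ n ] (NF (sub θ t) n × m ≡ n ∷ n ∷ [])

    posPart : Subst → Clause → List (List Term)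
    posPart θ [] = []
    posPart θ (pos s t ∷ C) = (sub θ s ∷ sub θ t ∷ []) ∷ posPart θ C
    posPart θ (neg s t ∷ C) = posPart θ C

    Closure : Set
    Closure = Clause × Subst

    NM : Closure → List (List Term) → Set
    NM (C , θ) M =
      Σ (List Term) λ S → Σ (List Term) λ T →
      Σ (List (List (List Term))) λ Ms → Σ (List (List Term)) λ Ns →
        Enumerates (InSS C) S × Enumerates (InTS C) T ×
        Pointwise (SSContrib θ) S Ms × Pointwise (TSContrib θ) T Ns ×
        M ≡ concat Ms ++ Ns ++ posPart θ C

  Closure : Set
  Closure = Clause × Subst

  groundInst : Closure → Clause
  groundInst (C , θ) = subC θ C

  GroundClosure : Closure → Set
  GroundClosure c = GroundC (groundInst c)

  _≈Clo_ : Closure → Closure → Set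
  (C , θ₁) ≈Clo (D , θ₂) =
    Σ (ℕ → ℕ) λ ρ → Σ (ℕ → ℕ) λ ρ⁻ →
      (∀ x → ρ⁻ (ρ x) ≡ x) × (∀ y → ρ (ρ⁻ y) ≡ y) ×
      (subC (λ x → var (ρ x)) C ≈C D) ×
      (∀ x → VarOfC x C → θ₁ x ≡ θ₂ (ρ x))

  InstanceOf : Clause → Clause → Set
  InstanceOf D C = Σ Subst λ ρ → subC ρ C ≈C D

  record IsClosureOrdering (_≻Clo_ : Closure → Closure → Set) : Set where
    field
      trans  : ∀ {a b c} → a ≻Clo b → b ≻Clo c → a ≻Clo c
      wf     : WellFounded (flip _≻Clo_)
      resp   : ∀ {a a' b b'} → a ≈Clo a' → b ≈Clo b' → a ≻Clo b → a' ≻Clo b'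
      total  : ∀ {a b} → GroundClosure a → GroundClosure b →
               groundInst a ≈C groundInst b → a ≻Clo b ⊎ b ≻Clo a ⊎ a ≈Clo b
      inst   : ∀ {C θ₁ D θ₂} → GroundClosure (C , θ₁) → GroundClosure (D , θ₂) →
               subC θ₁ C ≈C subC θ₂ D → InstanceOf D C → ¬ InstanceOf C D →
               (C , θ₁) ≻Clo (D , θ₂)

  module ClosureOrder (_≻_ : Term → Term → Set) (R : Term → Term → Set)
                      (_≻Clo_ : Closure → Closure → Set) where
    open Orders _≻_
    open Rewriting R using (NM)

    _≻ms_ : List Term → List Term → Set
    _≻ms_ = MulExt _≡_ _≻_

    _≻nm_ : List (List Term) → List (List Term) → Set
    _≻nm_ = MulExt (Permutation _≡_) _≻ms_

    _≈nm_ : List (List Term) → List (List Term) → Set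
    _≈nm_ = Permutation (Permutation _≡_)

    _≻≻_ : Closure → Closure → Set
    c₁ ≻≻ c₂ =
      Σ (List (List Term)) λ M₁ → Σ (List (List Term)) λ M₂ →
        NM c₁ M₁ × NM c₂ M₂ ×
        (M₁ ≻nm M₂ ⊎
         (M₁ ≈nm M₂ ×
          (groundInst c₁ ≻C groundInst c₂ ⊎
           (groundInst c₁ ≈C groundInst c₂ × c₁ ≻Clo c₂))))

    _≺≺_ : Closure → Closure → Set
    c₁ ≺≺ c₂ = c₂ ≻≻ c₁

  module Inference (_≻_ : Term → Term → Set) where
    open Orders _≻_

    BadOccCond : Subst → Term → Clause → Clause → Set
    BadOccCond θ w Dcl C =
      ((∃[ a ] ∃[ b ] (neg a b ∈ C × (Subterm w a ⊎ Subterm w b))) ⊎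
       (∃[ a ] ∃[ b ] (pos a b ∈ C × (ProperSubterm w a ⊎ ProperSubterm w b)))) →
      subC θ C ≻C subC θ Dcl

    MainOccCond : Subst → Term → Clause → Set
    MainOccCond θ w C =
      ∃[ s ] ∃[ s' ] ∃[ rest ] (Subterm w s × (sub θ s ≻ sub θ s') ×
        ((C ≈C (pos s s' ∷ rest) × StrictMaxRest θ (pos s s') rest) ⊎
         (C ≈C (neg s s' ∷ rest) × MaxRest θ (neg s s') rest)))

    LeftCond : Subst → Clause → Term → Term → Set
    LeftCond θ D' t t' = StrictMaxRest θ (pos t t') D' × (sub θ t ≻ sub θ t')

    data ParSup (D' : Clause) (t t' : Term) (C : Clause) (θ : Subst) : Closure → Set where
      typeI : ∀ (u : Term) (σ : Subst) (C' : Clause) →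
        (∀ x → VarOfC x (pos t t' ∷ D') → ¬ VarOfC x C) →
        GroundC (subC θ (pos t t' ∷ D')) → GroundC (subC θ C) →
        ¬ IsVar u →
        sub θ t ≡ sub θ u →
        IsMGU σ t u →
        ReplAllC u t' C C' →
        BadOccCond θ u (pos t t' ∷ D') C →
        MainOccCond θ u C →
        LeftCond θ D' t t' →
        ParSup D' t t' C θ (subC σ (D' ++ C') , θ)
      typeII : ∀ (x : ℕ) (r : Term) →
        (∀ y → VarOfC y (pos t t' ∷ D') → ¬ VarOfC y C) →
        GroundC (subC θ (pos t t' ∷ D')) → GroundC (subC θ C) →
        VarOfC x C →
        Repl1 (sub θ t) (sub θ t') (θ x) r →
        BadOccCond θ (var x) (pos t t' ∷ D') C →
        MainOccCond θ (var x) C →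
        LeftCond θ D' t t' →
        ParSup D' t t' C θ (D' ++ C , update θ x r)

-- Already the first component of ≻≻_R decreases. If the rewritten occurrence lies in the strictly maximal
-- literal s ≈ s' of C, the pair {sθ, s'θ} ∈ nm_R(C · θ) dominates every element of nm_R of the conclusion:
-- literals of C are only rewritten downwards, and those of D' lie below t ≈ t', hence below s ≈ s'. The one
-- exception, sθ = tθ with s'θ ≺ t'θ, would put all of nm_R(C · θ) below {tθ, t'θ} ∈ nm_R(D' ∨ t ≈ t' · θ),
-- contradicting (D' ∨ t ≈ t' · θ) ≺≺_R (C · θ).
-- If the occurrence lies in a maximal negative literal, u (resp. x) belongs to ss⁻(C), and as tθ → t'θ ∈ R
-- applies at the top of a term with irreducible arguments, its rm_R-contribution contains {tθ, tθ}. Matching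
-- the elements of ss⁻ and ts⁻ of the conclusion with those of C, every contribution is either inherited from C,
-- rewriting not changing normal forms, or consists of pairs below {tθ, tθ}; and {tθ, tθ} itself is removed.

module Submission where

open import Defs
open import Level using (0ℓ)
open import Data.Nat.Base using (ℕ; zero; suc; _+_; _≤_; _<_; s≤s; _≡ᵇ_)
import Data.Nat.Properties as ℕ
open import Data.Bool.Base using (true; false)
import Data.Bool.Base as Bool
open import Data.Unit.Base using (tt)
open import Data.Fin.Base using (Fin; zero; suc)
import Data.Fin.Properties as Fin
open import Data.Vec.Base using (Vec; []; _∷_; lookup; _[_]≔_; replicate)
open import Data.Vec.Properties using (lookup∘update; lookup∘update′; []≔-idempotent; []≔-commutes; []≔-lookup; lookup-replicate)
import Data.Vec.Relation.Binary.Pointwise.Inductive as VecPW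
open import Data.List.Base using (List; []; _∷_; _++_; map; concat; deduplicate)
import Data.List.Properties as List
open import Data.List.Relation.Unary.All using (All; []; _∷_)
import Data.List.Relation.Unary.All as All
import Data.List.Relation.Unary.All.Properties as All
open import Data.List.Relation.Unary.Any using (Any; here; there)
import Data.List.Relation.Unary.Any as Any
import Data.List.Relation.Unary.Any.Properties as Any
open import Data.List.Relation.Unary.Unique.Propositional using (Unique; []; _∷_)
import Data.List.Relation.Unary.Unique.DecPropositional.Properties as Unique
open import Data.List.Relation.Binary.Pointwise using (Pointwise; []; _∷_)
open import Data.List.Relation.Binary.Permutation.Homogeneous using (Permutation)
import Data.List.Relation.Binary.Permutation.Homogeneous as Homogeneous
import Data.List.Relation.Binary.Permutation.Setoid as SetoidPerm
import Data.List.Relation.Binary.Permutation.Setoid.Properties as SetoidPermProps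
open import Data.List.Membership.Propositional using (_∈_; find)
open import Data.List.Membership.Propositional.Properties using (∈-++⁺ˡ; ∈-++⁺ʳ; ∈-++⁻; ∈-∃++; ∈-concat⁻; ∈-map⁻; ∈-deduplicate⁻; ∈-deduplicate⁺)
open import Data.Product using (Σ; ∃-syntax; _×_; _,_; proj₁; proj₂; swap)
open import Data.Sum using (_⊎_; inj₁; inj₂; map₂)
open import Data.Empty using (⊥; ⊥-elim)
open import Relation.Nullary using (¬_; Dec; yes; no)
open import Relation.Binary.Bundles using (Setoid)
open import Relation.Binary.Definitions using (DecidableEquality)
open import Relation.Binary.PropositionalEquality
open import Relation.Binary.Construct.Closure.ReflexiveTransitive using (Star; ε; _◅_; _◅◅_; gmap)
open import Induction.WellFounded using (Acc; acc)

module Terms (Sig : Signature) where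
  open Signature Sig
  open Fol Sig

  mutual
    size : Term → ℕ
    size (var x) = 1
    size (fun f ts) = suc (sizes ts)

    sizes : ∀ {n} → Vec Term n → ℕ
    sizes [] = 0
    sizes (t ∷ ts) = size t + sizes ts

  size-lookup≤sizes : ∀ {n} (ts : Vec Term n) i → size (lookup ts i) ≤ sizes ts
  size-lookup≤sizes (t ∷ ts) zero = ℕ.m≤m+n (size t) (sizes ts)
  size-lookup≤sizes (t ∷ ts) (suc i) = ℕ.≤-trans (size-lookup≤sizes ts i) (ℕ.m≤n+m (sizes ts) (size t))

  Subterm⇒size≤ : ∀ {e s} → Subterm e s → size e ≤ size s
  Subterm⇒size≤ top = ℕ.≤-refl
  Subterm⇒size≤ (arg {ts = ts} i p) = ℕ.m≤n⇒m≤1+n (ℕ.≤-trans (Subterm⇒size≤ p) (size-lookup≤sizes ts i))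

  ProperSubterm⇒size< : ∀ {e s} → ProperSubterm e s → size e < size s
  ProperSubterm⇒size< (arg {ts = ts} i p) = s≤s (ℕ.≤-trans (Subterm⇒size≤ p) (size-lookup≤sizes ts i))

  ProperSubterm⇒Subterm : ∀ {e s} → ProperSubterm e s → Subterm e s
  ProperSubterm⇒Subterm (arg i p) = arg i p

  ProperSubterm⇒≢ : ∀ {e s} → ProperSubterm e s → e ≢ s
  ProperSubterm⇒≢ p refl = ℕ.<-irrefl refl (ProperSubterm⇒size< p)

  Subterm⇒≡⊎ProperSubterm : ∀ {e s} → Subterm e s → e ≡ s ⊎ ProperSubterm e s
  Subterm⇒≡⊎ProperSubterm top = inj₁ refl
  Subterm⇒≡⊎ProperSubterm (arg i p) = inj₂ (arg i p)

  Subterm-trans : ∀ {a b c} → Subterm a b → Subterm b c → Subterm a c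
  Subterm-trans p top = p
  Subterm-trans p (arg i q) = arg i (Subterm-trans p q)

  Subterm-ProperSubterm-trans : ∀ {a b c} → Subterm a b → ProperSubterm b c → ProperSubterm a c
  Subterm-ProperSubterm-trans p (arg i q) = arg i (Subterm-trans p q)

  ProperSubterm-Subterm-trans : ∀ {a b c} → ProperSubterm a b → Subterm b c → ProperSubterm a c
  ProperSubterm-Subterm-trans p top = p
  ProperSubterm-Subterm-trans p (arg i q) = arg i (Subterm-trans (ProperSubterm⇒Subterm p) q)

  Ground-Subterm : ∀ {e s} → Ground s → Subterm e s → Ground e
  Ground-Subterm g p x q = g x (Subterm-trans q p)

  var≢fun : ∀ {x f ts} → var x ≢ fun f ts
  var≢fun ()

  fun-injectiveˡ : ∀ {f f' ts ts'} → fun f ts ≡ fun f' ts' → f ≡ f'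
  fun-injectiveˡ refl = refl

  fun-injectiveʳ : ∀ {f ts ts'} → fun f ts ≡ fun f ts' → ts ≡ ts'
  fun-injectiveʳ refl = refl

  ¬IsVar⇒fun : ∀ w → ¬ IsVar w → ∃[ f ] ∃[ ws ] (w ≡ fun f ws)
  ¬IsVar⇒fun (var x) nv = ⊥-elim (nv (x , refl))
  ¬IsVar⇒fun (fun f ws) _ = f , ws , refl

  mutual
    VarOf? : ∀ x w → Dec (VarOf x w)
    VarOf? x (var y) with x ℕ.≟ y
    ... | yes refl = yes top
    ... | no x≢y = no λ { top → x≢y refl }
    VarOf? x (fun f ws) with VarOfArgs? x ws
    ... | yes (i , p) = yes (arg i p)
    ... | no ¬p = no λ { (arg i p) → ¬p (i , p) }

    VarOfArgs? : ∀ {n} x (ws : Vec Term n) → Dec (∃[ i ] VarOf x (lookup ws i))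
    VarOfArgs? x [] = no λ { (() , _) }
    VarOfArgs? x (w ∷ ws) with VarOf? x w | VarOfArgs? x ws
    ... | yes p | _ = yes (zero , p)
    ... | no _ | yes (i , p) = yes (suc i , p)
    ... | no ¬p | no ¬q = no λ { (zero , p) → ¬p p ; (suc i , p) → ¬q (i , p) }

  update-≡ : ∀ θ x r → update θ x r x ≡ r
  update-≡ θ x r with x ≡ᵇ x in eq
  ... | true = refl
  ... | false = ⊥-elim (subst Bool.T eq (ℕ.≡⇒≡ᵇ x x refl))

  update-≢ : ∀ θ x r {y} → x ≢ y → update θ x r y ≡ θ y
  update-≢ θ x r {y} x≢y with x ≡ᵇ y in eq
  ... | true = ⊥-elim (x≢y (ℕ.≡ᵇ⇒≡ x y (subst Bool.T (sym eq) tt)))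
  ... | false = refl

  _∘ₛ_ : Subst → Subst → Subst
  (θ ∘ₛ σ) x = sub θ (σ x)

  lookup-subs : ∀ {n} θ (ts : Vec Term n) i → lookup (subs θ ts) i ≡ sub θ (lookup ts i)
  lookup-subs θ (t ∷ ts) zero = refl
  lookup-subs θ (t ∷ ts) (suc i) = lookup-subs θ ts i

  mutual
    sub-∘ : ∀ θ σ w → sub θ (sub σ w) ≡ sub (θ ∘ₛ σ) w
    sub-∘ θ σ (var x) = refl
    sub-∘ θ σ (fun f ts) = cong (fun f) (subs-∘ θ σ ts)

    subs-∘ : ∀ {n} θ σ (ts : Vec Term n) → subs θ (subs σ ts) ≡ subs (θ ∘ₛ σ) ts
    subs-∘ θ σ [] = refl
    subs-∘ θ σ (t ∷ ts) = cong₂ _∷_ (sub-∘ θ σ t) (subs-∘ θ σ ts)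

  mutual
    sub-ext : ∀ {θ₁ θ₂} w → (∀ x → VarOf x w → θ₁ x ≡ θ₂ x) → sub θ₁ w ≡ sub θ₂ w
    sub-ext (var x) h = h x top
    sub-ext (fun f ts) h = cong (fun f) (subs-ext ts λ x i p → h x (arg i p))

    subs-ext : ∀ {n θ₁ θ₂} (ts : Vec Term n) → (∀ x i → VarOf x (lookup ts i) → θ₁ x ≡ θ₂ x) →
               subs θ₁ ts ≡ subs θ₂ ts
    subs-ext [] h = refl
    subs-ext (t ∷ ts) h = cong₂ _∷_ (sub-ext t λ x → h x zero) (subs-ext ts λ x i → h x (suc i))

  Subterm-sub : ∀ σ {v w} → Subterm v w → Subterm (sub σ v) (sub σ w)
  Subterm-sub σ top = top
  Subterm-sub σ (arg {ts = ts} i p) = arg i (subst (Subterm _) (sym (lookup-subs σ ts i)) (Subterm-sub σ p))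

  ProperSubterm-sub : ∀ σ {v w} → ProperSubterm v w → ProperSubterm (sub σ v) (sub σ w)
  ProperSubterm-sub σ (arg {ts = ts} i p) = arg i (subst (Subterm _) (sym (lookup-subs σ ts i)) (Subterm-sub σ p))

  mutual
    Subterm-of-sub : ∀ σ {e} w → Subterm e (sub σ w) →
      (∃[ v ] (Subterm v w × e ≡ sub σ v)) ⊎ (∃[ y ] (VarOf y w × ProperSubterm e (σ y)))
    Subterm-of-sub σ (var y) q with Subterm⇒≡⊎ProperSubterm q
    ... | inj₁ e≡ = inj₁ (var y , top , e≡)
    ... | inj₂ pr = inj₂ (y , top , pr)
    Subterm-of-sub σ (fun f ws) top = inj₁ (fun f ws , top , refl)
    Subterm-of-sub σ (fun f ws) (arg i q) with Subterm-of-subs σ ws i q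
    ... | inj₁ (v , p , e≡) = inj₁ (v , arg i p , e≡)
    ... | inj₂ (y , p , pr) = inj₂ (y , arg i p , pr)

    Subterm-of-subs : ∀ σ {e n} (ws : Vec Term n) i → Subterm e (lookup (subs σ ws) i) →
      (∃[ v ] (Subterm v (lookup ws i) × e ≡ sub σ v)) ⊎ (∃[ y ] (VarOf y (lookup ws i) × ProperSubterm e (σ y)))
    Subterm-of-subs σ (w ∷ ws) zero q = Subterm-of-sub σ w q
    Subterm-of-subs σ (w ∷ ws) (suc i) q = Subterm-of-subs σ ws i q

  Repl1⇒Subterm : ∀ {a b s s'} → Repl1 a b s s' → Subterm a s
  Repl1⇒Subterm here = top
  Repl1⇒Subterm (inside i p) = arg i (Repl1⇒Subterm p)

  Repl1-lift : ∀ {a b e e' s} → Subterm e s → Repl1 a b e e' → ∃[ s' ] Repl1 a b s s'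
  Repl1-lift top r = _ , r
  Repl1-lift (arg i p) r = _ , inside i (proj₂ (Repl1-lift p r))

  inside-≡ : ∀ {a b x y f} {ts : Vec Term (arity f)} i → lookup ts i ≡ x → Repl1 a b x y →
             Repl1 a b (fun f ts) (fun f (ts [ i ]≔ y))
  inside-≡ i refl p = inside i p

  Repl1-under : ∀ {a b x y f} (ts : Vec Term (arity f)) i → Repl1 a b x y →
                Repl1 a b (fun f (ts [ i ]≔ x)) (fun f (ts [ i ]≔ y))
  Repl1-under {a} {b} {x} {f = f} ts i p =
    subst (λ z → Repl1 a b (fun f (ts [ i ]≔ x)) (fun f z)) ([]≔-idempotent ts i)
      (inside-≡ i (lookup∘update i ts x) p)

  data Context : Set where
    hole : Context
    at   : (f : Fun) (ts : Vec Term (arity f)) (i : Fin (arity f)) → Context → Context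

  plug : Context → Term → Term
  plug hole a = a
  plug (at f ts i c) a = fun f (ts [ i ]≔ plug c a)

  Repl1-plug : ∀ {a b} c → Repl1 a b (plug c a) (plug c b)
  Repl1-plug hole = here
  Repl1-plug (at f ts i c) = Repl1-under ts i (Repl1-plug c)

  Subterm⇒plug : ∀ {e s} → Subterm e s → ∃[ c ] (s ≡ plug c e)
  Subterm⇒plug top = hole , refl
  Subterm⇒plug (arg {f} {ts} i q) with Subterm⇒plug q
  ... | c , eq = at f ts i c , cong (fun f) (trans (sym ([]≔-lookup ts i)) (cong (ts [ i ]≔_) eq))

  mutual
    ReplAll-functional : ∀ {a b s s₁ s₂} → ReplAll a b s s₁ → ReplAll a b s s₂ → s₁ ≡ s₂
    ReplAll-functional hit hit = refl
    ReplAll-functional hit (varR ne) = ⊥-elim (ne refl)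
    ReplAll-functional hit (funR ne _) = ⊥-elim (ne refl)
    ReplAll-functional (varR ne) hit = ⊥-elim (ne refl)
    ReplAll-functional (varR _) (varR _) = refl
    ReplAll-functional (funR ne _) hit = ⊥-elim (ne refl)
    ReplAll-functional (funR _ rs) (funR _ rs') = cong (fun _) (ReplAlls-functional rs rs')

    ReplAlls-functional : ∀ {a b n} {ts ts₁ ts₂ : Vec Term n} →
                          ReplAlls a b ts ts₁ → ReplAlls a b ts ts₂ → ts₁ ≡ ts₂
    ReplAlls-functional [] [] = refl
    ReplAlls-functional (r ∷ rs) (r' ∷ rs') = cong₂ _∷_ (ReplAll-functional r r') (ReplAlls-functional rs rs')

  ReplAlls-lookup : ∀ {a b n} {ts ts' : Vec Term n} → ReplAlls a b ts ts' → ∀ i →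
                    ReplAll a b (lookup ts i) (lookup ts' i)
  ReplAlls-lookup (r ∷ rs) zero = r
  ReplAlls-lookup (r ∷ rs) (suc i) = ReplAlls-lookup rs i

  Subterm-of-ReplAll : ∀ {a b s s' e} → ReplAll a b s s' → Subterm e s' →
    Subterm e b ⊎ (∃[ c ] (Subterm c s × ReplAll a b c e × c ≢ a))
  Subterm-of-ReplAll hit p = inj₁ p
  Subterm-of-ReplAll (varR ne) top = inj₂ (_ , top , varR ne , ne)
  Subterm-of-ReplAll (funR ne rs) top = inj₂ (_ , top , funR ne rs , ne)
  Subterm-of-ReplAll (funR ne rs) (arg i p) with Subterm-of-ReplAll (ReplAlls-lookup rs i) p
  ... | inj₁ q = inj₁ q
  ... | inj₂ (c , q , r , c≢a) = inj₂ (c , arg i q , r , c≢a)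

module MultisetsOfMultisets (A : Set) where
  ListSetoid : Setoid 0ℓ 0ℓ
  ListSetoid = Homogeneous.setoid {R = _≡_ {A = A}} refl sym

  open SetoidPerm ListSetoid public using () renaming
    (_↭_ to _≈_; ↭-refl to ≈-refl; ↭-sym to ≈-sym; ↭-trans to ≈-trans; ↭-prep to ≈-prep; ↭-swap to ≈-swap;
      ↭-reflexive to ≈-reflexive)
  open SetoidPermProps ListSetoid public using () renaming
    (∈-resp-↭ to ∈-resp-≈; ++⁺ to ++⁺-≈; ++-assoc to ++-assoc-≈; ++-comm to ++-comm-≈; shifts to shifts-≈)

  interchange : ∀ a b c d → (a ++ b) ++ (c ++ d) ≈ (a ++ c) ++ (b ++ d)
  interchange a b c d =
    ≈-trans (++-assoc-≈ a b (c ++ d))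
      (≈-trans (++⁺-≈ (≈-refl {a}) (shifts-≈ b c)) (≈-sym (++-assoc-≈ a c (b ++ d))))

  ≈-++-[] : ∀ M → M ≈ M ++ []
  ≈-++-[] M = ≈-reflexive (sym (List.++-identityʳ M))

  module _ {I : Set} (Contrib : I → List (List A) → Set) where

    Pointwise-remove : ∀ {S Ms c} → Pointwise Contrib S Ms → c ∈ S →
      ∃[ S' ] ∃[ Ms' ] ∃[ Mc ] (Contrib c Mc × Pointwise Contrib S' Ms' ×
        concat Ms ≈ Mc ++ concat Ms' × (∀ d → d ∈ S → d ≢ c → d ∈ S'))
    Pointwise-remove (_∷_ {ys = Ms} r rs) (here refl) =
      _ , Ms , _ , r , rs , ≈-refl , λ { d (here refl) d≢c → ⊥-elim (d≢c refl) ; d (there m) _ → m }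
    Pointwise-remove (_∷_ {x = a} {y = Ma} r rs) (there m) with Pointwise-remove rs m
    ... | S' , Ms' , Mc , rc , pw , eq , mem =
      a ∷ S' , Ma ∷ Ms' , Mc , rc , r ∷ pw , ≈-trans (++⁺-≈ (≈-refl {Ma}) eq) (shifts-≈ Ma Mc) ,
      λ { d (here refl) _ → here refl ; d (there m') d≢c → there (mem d m' d≢c) }

  -- Elements e of the new index list are matched injectively with old indices c whose contribution splits
  -- into that of e plus a remainder; unmatched e contribute only small elements. This yields old ≈ Z ++ X
  -- and new ≈ Z ++ Y with Y small, X keeping the big elements contributed by marked indices.
  module Matching {I : Set} (_≟_ : DecidableEquality I)
    (Old New : I → List (List A) → Set) (Image : I → I → Set)
    (Image-functional : ∀ {c e e'} → Image c e → Image c e' → e ≡ e')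
    (Small Big : List A → Set) (Marked : I → Set)
    (marked⇒big : ∀ {c M} → Marked c → Old c M → Any Big M) where

    Transfer : I → I → Set
    Transfer c e = ∀ M → Old c M → ∃[ M' ] ∃[ E ] (New e M' × M ≈ M' ++ E × (Marked c → Any Big E))

    Choice : List I → I → Set
    Choice S e = (∃[ c ] (c ∈ S × Image c e × Transfer c e)) ⊎ (∃[ M ] (New e M × All Small M))

    Matched : List I → List (List (List A)) → List I → Set
    Matched S Ms SN = ∃[ Ms' ] (Pointwise New SN Ms' × ∃[ Z ] ∃[ X ] ∃[ Y ]
      (concat Ms ≈ Z ++ X × concat Ms' ≈ Z ++ Y × All Small Y × (∀ {c} → Marked c → c ∈ S → Any Big X)))

    marked-in-concat : ∀ {S Ms c} → Pointwise Old S Ms → c ∈ S → Marked c → Any Big (concat Ms)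
    marked-in-concat (r ∷ _) (here refl) mc = Any.++⁺ˡ (marked⇒big mc r)
    marked-in-concat (_∷_ {y = M} _ rs) (there m) mc = Any.++⁺ʳ M (marked-in-concat rs m mc)

    choice-without : ∀ {S S' SN e c} → (∀ d → d ∈ S → d ≢ c → d ∈ S') → Image c e → All (e ≢_) SN →
      (∀ e' → e' ∈ SN → Choice S e') → ∀ e' → e' ∈ SN → Choice S' e'
    choice-without mem img e∉SN ch e' m with ch e' m
    ... | inj₂ small = inj₂ small
    ... | inj₁ (c' , c'∈ , img' , tr) with c' ≟ _
    ...   | no c'≢c = inj₁ (c' , mem c' c'∈ c'≢c , img' , tr)
    ...   | yes refl = ⊥-elim (All.lookup e∉SN m (Image-functional img img'))

    match : ∀ S Ms → Pointwise Old S Ms → (SN : List I) → Unique SN → (∀ e → e ∈ SN → Choice S e) →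
            Matched S Ms SN
    match S Ms pw [] _ _ = [] , [] , [] , concat Ms , [] , ≈-refl , ≈-refl , [] , λ mc m → marked-in-concat pw m mc
    match S Ms pw (e ∷ SN) (e∉SN ∷ uniq) ch with ch e (here refl)
    ... | inj₂ (M , new , small) with match S Ms pw SN uniq (λ e' m → ch e' (there m))
    ...   | Ms' , pw' , Z , X , Y , eqOld , eqNew , smallY , marked =
            M ∷ Ms' , new ∷ pw' , Z , X , M ++ Y , eqOld , ≈-trans (++⁺-≈ (≈-refl {M}) eqNew) (shifts-≈ M Z) ,
            All.++⁺ small smallY , marked
    match S Ms pw (e ∷ SN) (e∉SN ∷ uniq) ch | inj₁ (c , c∈S , img , transfer) with Pointwise-remove Old pw c∈S
    ... | S' , Ms⁻ , Mc , old , pw⁻ , eqS , mem with transfer Mc old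
    ...   | M' , E , new , eqMc ,
      bigE with match S' Ms⁻ pw⁻ SN uniq (choice-without mem img e∉SN (λ e' m → ch e' (there m)))
    ...     | Ms' , pw' , Z , X , Y , eqOld , eqNew , smallY , marked =
              M' ∷ Ms' , new ∷ pw' , M' ++ Z , E ++ X , Y ,
              ≈-trans eqS (≈-trans (++⁺-≈ eqMc eqOld) (interchange M' E Z X)) ,
              ≈-trans (++⁺-≈ (≈-refl {M'}) eqNew) (≈-sym (++-assoc-≈ M' Z Y)) , smallY , marked'
      where
      marked' : ∀ {c₀} → Marked c₀ → c₀ ∈ S → Any Big (E ++ X)
      marked' {c₀} mc m with c₀ ≟ c
      ... | yes refl = Any.++⁺ˡ (bigE mc)
      ... | no c₀≢c = Any.++⁺ʳ E (marked mc (mem c₀ m c₀≢c))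

module GroundOrder (Sig : Signature) (_≻_ : Fol.Term Sig → Fol.Term Sig → Set)
                   (ro : Fol.IsReductionOrdering Sig _≻_) (tot : Fol.TotalOnGround Sig _≻_) where
  open Signature Sig
  open Fol Sig
  open Terms Sig
  module ≻ = IsReductionOrdering ro
  open SetoidPerm (setoid Term) using (_↭_; ↭-refl; ↭-sym; ↭-trans; ↭-prep; ↭-swap)
  open SetoidPermProps (setoid Term) using (∈-resp-↭; drop-∷; dropMiddleElement)
  open MultisetsOfMultisets Term renaming (_≈_ to _≈nm_)

  _≽_ : Term → Term → Set
  s ≽ t = s ≡ t ⊎ s ≻ t

  ≻-asym : ∀ {s t} → s ≻ t → ¬ (t ≻ s)
  ≻-asym p q = ≻.irrefl (≻.trans p q)

  ≽-trans : ∀ {a b c} → a ≽ b → b ≽ c → a ≽ c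
  ≽-trans (inj₁ refl) q = q
  ≽-trans (inj₂ p) (inj₁ refl) = inj₂ p
  ≽-trans (inj₂ p) (inj₂ q) = inj₂ (≻.trans p q)

  ≻-≽-trans : ∀ {a b c} → a ≻ b → b ≽ c → a ≻ c
  ≻-≽-trans p (inj₁ refl) = p
  ≻-≽-trans p (inj₂ q) = ≻.trans p q

  ≽-≻-trans : ∀ {a b c} → a ≽ b → b ≻ c → a ≻ c
  ≽-≻-trans (inj₁ refl) q = q
  ≽-≻-trans (inj₂ p) q = ≻.trans p q

  ≽⇒≯ : ∀ {a b} → a ≽ b → ¬ (b ≻ a)
  ≽⇒≯ (inj₁ refl) q = ≻.irrefl q
  ≽⇒≯ (inj₂ p) q = ≻-asym p q

  ≡-ground? : ∀ {a b} → Ground a → Ground b → Dec (a ≡ b)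
  ≡-ground? ga gb with tot ga gb
  ... | inj₁ a≡b = yes a≡b
  ... | inj₂ (inj₁ a≻b) = no λ { refl → ≻.irrefl a≻b }
  ... | inj₂ (inj₂ b≻a) = no λ { refl → ≻.irrefl b≻a }

  -- By monotonicity, a ≻ c[a] would start the infinite descent a ≻ c[a] ≻ c[c[a]] ≻ ⋯
  ¬≻-plug : ∀ c a → Acc (λ x y → y ≻ x) a → ¬ (a ≻ plug c a)
  ¬≻-plug c a (acc rs) a≻ca = ¬≻-plug c (plug c a) (rs a≻ca) (≻.monotone a≻ca (Repl1-plug c))

  ProperSubterm⇒≻ : ∀ {e s} → Ground s → ProperSubterm e s → s ≻ e
  ProperSubterm⇒≻ {e} gs pr with tot gs (Ground-Subterm gs (ProperSubterm⇒Subterm pr))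
  ... | inj₁ s≡e = ⊥-elim (ProperSubterm⇒≢ pr (sym s≡e))
  ... | inj₂ (inj₁ s≻e) = s≻e
  ... | inj₂ (inj₂ e≻s) with Subterm⇒plug (ProperSubterm⇒Subterm pr)
  ...   | c , refl = ⊥-elim (¬≻-plug c e (≻.wf e) e≻s)

  Subterm⇒≽ : ∀ {e s} → Ground s → Subterm e s → s ≽ e
  Subterm⇒≽ gs p with Subterm⇒≡⊎ProperSubterm p
  ... | inj₁ e≡s = inj₁ (sym e≡s)
  ... | inj₂ pr = inj₂ (ProperSubterm⇒≻ gs pr)

  _≻ms_ : List Term → List Term → Set
  _≻ms_ = MulExt _≡_ _≻_

  _≻nm_ : List (List Term) → List (List Term) → Set
  _≻nm_ = MulExt (Permutation _≡_) _≻ms_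

  ≻ms-respˡ-↭ : ∀ {A A' B} → A ↭ A' → A ≻ms B → A' ≻ms B
  ≻ms-respˡ-↭ p (Z , X , Y , pA , pB , X≢[] , dom) = Z , X , Y , ↭-trans (↭-sym p) pA , pB , X≢[] , dom

  ≻ms-respʳ-↭ : ∀ {A B B'} → B ↭ B' → A ≻ms B → A ≻ms B'
  ≻ms-respʳ-↭ p (Z , X , Y , pA , pB , X≢[] , dom) = Z , X , Y , pA , ↭-trans (↭-sym p) pB , X≢[] , dom

  ∈-singleton⁻ : ∀ {a b : Term} → a ∈ (b ∷ []) → a ≡ b
  ∈-singleton⁻ (here a≡b) = a≡b

  ↭-pair⁻ : ∀ {a b c d} → (a ∷ b ∷ []) ↭ (c ∷ d ∷ []) → (a ≡ c × b ≡ d) ⊎ (a ≡ d × b ≡ c)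
  ↭-pair⁻ {a} {b} {c} {d} p with ∈-resp-↭ p (here refl)
  ... | here refl = inj₁ (refl , ∈-singleton⁻ (∈-resp-↭ (drop-∷ p) (here refl)))
  ... | there (here refl) = inj₂ (refl , ∈-singleton⁻ (∈-resp-↭ (drop-∷ (↭-trans p (↭-swap c a ↭-refl))) (here refl)))

  ↭-pair-twice : ∀ {s b Z X} → (s ∷ b ∷ []) ↭ (Z ++ X) → s ∈ Z → s ∈ X → s ≡ b
  ↭-pair-twice {s} {b} {Z} {X} p s∈Z s∈X with ∈-∃++ s∈Z
  ... | Z₁ , Z₂ , refl = ∈-singleton⁻ (∈-resp-↭ (↭-sym rest) (∈-++⁺ʳ Z₁ (∈-++⁺ʳ Z₂ s∈X)))
    where
    rest : (b ∷ []) ↭ (Z₁ ++ (Z₂ ++ X))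
    rest = dropMiddleElement [] Z₁ (subst ((s ∷ b ∷ []) ↭_) (List.++-assoc Z₁ (s ∷ Z₂) X) p)

  ≽-pair⇒≡⊎≻ms : ∀ {a b a' b'} → a ≽ a' → b ≽ b' →
      _≡_ {A = List Term} (a ∷ b ∷ []) (a' ∷ b' ∷ []) ⊎ (a ∷ b ∷ []) ≻ms (a' ∷ b' ∷ [])
  ≽-pair⇒≡⊎≻ms (inj₁ refl) (inj₁ refl) = inj₁ refl
  ≽-pair⇒≡⊎≻ms {a} {b} {a'} (inj₂ a≻a') (inj₁ refl) =
    inj₂ (b ∷ [] , a ∷ [] , a' ∷ [] , ↭-swap a b ↭-refl , ↭-swap a' b ↭-refl , (λ ()) , here a≻a' ∷ [])
  ≽-pair⇒≡⊎≻ms {a} {b} {a'} {b'} (inj₁ refl) (inj₂ b≻b') =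
    inj₂ (a ∷ [] , b ∷ [] , b' ∷ [] , ↭-refl , ↭-refl , (λ ()) , here b≻b' ∷ [])
  ≽-pair⇒≡⊎≻ms {a} {b} {a'} {b'} (inj₂ a≻a') (inj₂ b≻b') =
    inj₂ ([] , a ∷ b ∷ [] , a' ∷ b' ∷ [] , ↭-refl , ↭-refl , (λ ()) , here a≻a' ∷ there (here b≻b') ∷ [])

  -- The shapes of {a, b} ≺ms {s, s'} when s ≻ s' and the order is total.
  data PairBelow (a b s s' : Term) : Set where
    both : s ≻ a → s ≻ b → PairBelow a b s s'
    fst  : a ≡ s → s' ≻ b → PairBelow a b s s'
    snd  : b ≡ s → s' ≻ a → PairBelow a b s s'

  PairBelow⇒≻ms : ∀ {a b s s'} → PairBelow a b s s' → (s ∷ s' ∷ []) ≻ms (a ∷ b ∷ [])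
  PairBelow⇒≻ms {a} {b} {s} {s'} (both s≻a s≻b) =
    [] , s ∷ s' ∷ [] , a ∷ b ∷ [] , ↭-refl , ↭-refl , (λ ()) , here s≻a ∷ here s≻b ∷ []
  PairBelow⇒≻ms {a} {b} {s} {s'} (fst refl s'≻b) =
    s ∷ [] , s' ∷ [] , b ∷ [] , ↭-refl , ↭-refl , (λ ()) , here s'≻b ∷ []
  PairBelow⇒≻ms {a} {b} {s} {s'} (snd refl s'≻a) =
    s ∷ [] , s' ∷ [] , a ∷ [] , ↭-refl , ↭-swap a b ↭-refl , (λ ()) , here s'≻a ∷ []

  PairBelow⇒≼ : ∀ {a b s s'} → s ≻ s' → PairBelow a b s s' → s ≽ a × s ≽ b
  PairBelow⇒≼ _ (both s≻a s≻b) = inj₂ s≻a , inj₂ s≻b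
  PairBelow⇒≼ s≻s' (fst refl s'≻b) = inj₁ refl , inj₂ (≻.trans s≻s' s'≻b)
  PairBelow⇒≼ s≻s' (snd refl s'≻a) = inj₂ (≻.trans s≻s' s'≻a) , inj₁ refl

  PairBelow-mono : ∀ {a b a' b' s s'} → s ≻ s' → a ≽ a' → b ≽ b' → PairBelow a b s s' → PairBelow a' b' s s'
  PairBelow-mono _ a≽a' b≽b' (both s≻a s≻b) = both (≻-≽-trans s≻a a≽a') (≻-≽-trans s≻b b≽b')
  PairBelow-mono _ (inj₁ refl) b≽b' (fst refl s'≻b) = fst refl (≻-≽-trans s'≻b b≽b')
  PairBelow-mono s≻s' (inj₂ s≻a') b≽b' (fst refl s'≻b) = both s≻a' (≻.trans s≻s' (≻-≽-trans s'≻b b≽b'))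
  PairBelow-mono _ a≽a' (inj₁ refl) (snd refl s'≻a) = snd refl (≻-≽-trans s'≻a a≽a')
  PairBelow-mono s≻s' a≽a' (inj₂ s≻b') (snd refl s'≻a) = both (≻.trans s≻s' (≻-≽-trans s'≻a a≽a')) s≻b'

  PairBelow-≻ : ∀ {a b s s' S S'} → s ≻ s' → S ≻ s → PairBelow a b s s' → PairBelow a b S S'
  PairBelow-≻ s≻s' S≻s below with PairBelow⇒≼ s≻s' below
  ... | s≽a , s≽b = both (≻-≽-trans S≻s s≽a) (≻-≽-trans S≻s s≽b)

  PairBelow-≽₂ : ∀ {a b s s' S'} → S' ≽ s' → PairBelow a b s s' → PairBelow a b s S'
  PairBelow-≽₂ _ (both s≻a s≻b) = both s≻a s≻b
  PairBelow-≽₂ S'≽s' (fst a≡s s'≻b) = fst a≡s (≽-≻-trans S'≽s' s'≻b)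
  PairBelow-≽₂ S'≽s' (snd b≡s s'≻a) = snd b≡s (≽-≻-trans S'≽s' s'≻a)

  module _ {s s' : Term} (gs : Ground s) (gs' : Ground s') (s≻s' : s ≻ s') where

    ≯ms⇒PairBelow : ∀ {a b} → Ground a → Ground b →
      ¬ (a ∷ b ∷ []) ≻ms (s ∷ s' ∷ []) → ¬ ((a ∷ b ∷ []) ↭ (s ∷ s' ∷ [])) → PairBelow a b s s'
    ≯ms⇒PairBelow {a} {b} ga gb ≯ ≉ with tot ga gs | tot gb gs
    ... | inj₂ (inj₁ a≻s) | _ =
      ⊥-elim (≯ ([] , a ∷ b ∷ [] , s ∷ s' ∷ [] , ↭-refl , ↭-refl , (λ ()) , here a≻s ∷ here (≻.trans a≻s s≻s') ∷ []))
    ... | _ | inj₂ (inj₁ b≻s) =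
      ⊥-elim (≯ ([] , a ∷ b ∷ [] , s ∷ s' ∷ [] , ↭-refl , ↭-refl , (λ ()) ,
        there (here b≻s) ∷ there (here (≻.trans b≻s s≻s')) ∷ []))
    ... | inj₂ (inj₂ s≻a) | inj₂ (inj₂ s≻b) = both s≻a s≻b
    ... | inj₁ refl | _ with tot gb gs'
    ...   | inj₁ refl = ⊥-elim (≉ ↭-refl)
    ...   | inj₂ (inj₁ b≻s') = ⊥-elim (≯ (s ∷ [] , b ∷ [] , s' ∷ [] , ↭-refl , ↭-refl , (λ ()) , here b≻s' ∷ []))
    ...   | inj₂ (inj₂ s'≻b) = fst refl s'≻b
    ≯ms⇒PairBelow {a} {b} ga gb ≯ ≉ | inj₂ (inj₂ s≻a) | inj₁ refl with tot ga gs'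
    ...   | inj₁ refl = ⊥-elim (≉ (↭-swap s' s ↭-refl))
    ...   | inj₂ (inj₁ a≻s') = ⊥-elim
      (≯ (s ∷ [] , a ∷ [] , s' ∷ [] , ↭-swap a s ↭-refl , ↭-refl , (λ ()) , here a≻s' ∷ []))
    ...   | inj₂ (inj₂ s'≻a) = snd refl s'≻a

    ≯ms⇒neg-below : ∀ {a b} → Ground a → Ground b → ¬ (a ∷ a ∷ b ∷ b ∷ []) ≻ms (s ∷ s' ∷ []) → s ≻ a × s ≻ b
    ≯ms⇒neg-below {a} {b} ga gb ≯ with tot ga gs | tot gb gs
    ... | inj₂ (inj₂ s≻a) | inj₂ (inj₂ s≻b) = s≻a , s≻b
    ... | inj₂ (inj₁ a≻s) | _ =
      ⊥-elim (≯ ([] , a ∷ a ∷ b ∷ b ∷ [] , s ∷ s' ∷ [] , ↭-refl , ↭-refl , (λ ()) ,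
        here a≻s ∷ here (≻.trans a≻s s≻s') ∷ []))
    ... | inj₁ refl | _ = ⊥-elim (≯ (s ∷ [] , s ∷ b ∷ b ∷ [] , s' ∷ [] , ↭-refl , ↭-refl , (λ ()) , here s≻s' ∷ []))
    ... | _ | inj₂ (inj₁ b≻s) =
      ⊥-elim (≯ ([] , a ∷ a ∷ b ∷ b ∷ [] , s ∷ s' ∷ [] , ↭-refl , ↭-refl , (λ ()) ,
                 there (there (here b≻s)) ∷ there (there (here (≻.trans b≻s s≻s'))) ∷ []))
    ... | _ | inj₁ refl = ⊥-elim
      (≯ (s ∷ [] , a ∷ a ∷ s ∷ [] , s' ∷ [] , ↭-move , ↭-refl , (λ ()) , there (there (here s≻s')) ∷ []))
      where
      ↭-move : (a ∷ a ∷ s ∷ s ∷ []) ↭ (s ∷ a ∷ a ∷ s ∷ [])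
      ↭-move = ↭-trans (↭-prep a (↭-swap a s ↭-refl)) (↭-swap a s ↭-refl)

  PairBelow⇒≉ : ∀ {a b s s'} → s ≻ s' → PairBelow a b s s' → ¬ ((a ∷ b ∷ []) ↭ (s ∷ s' ∷ []))
  PairBelow⇒≉ s≻s' below p with ↭-pair⁻ p | below
  ... | inj₁ (refl , _) | both s≻a _ = ≻.irrefl s≻a
  ... | inj₁ (_ , refl) | fst _ s'≻b = ≻.irrefl s'≻b
  ... | inj₁ (_ , refl) | snd refl _ = ≻.irrefl s≻s'
  ... | inj₂ (_ , refl) | both _ s≻b = ≻.irrefl s≻b
  ... | inj₂ (refl , _) | fst refl _ = ≻.irrefl s≻s'
  ... | inj₂ (refl , _) | snd _ s'≻a = ≻.irrefl s'≻a

  private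
    ordered-PairBelow⇒≯ms : ∀ {a b s s'} → s ≻ s' → (s ≻ a × s ≻ b) ⊎ (a ≡ s × s' ≻ b) →
                            ¬ (a ∷ b ∷ []) ≻ms (s ∷ s' ∷ [])
    ordered-PairBelow⇒≯ms {a} {b} {s} {s'} s≻s' below (Z , X , Y , pA , pB , _ , dom) = absurd below
      where
      inPair : ∀ {z} → z ∈ Z ++ X → z ∈ (a ∷ b ∷ [])
      inPair = ∈-resp-↭ (↭-sym pA)

      bounded : ∀ {z} → z ∈ Z ++ X → s ≽ z
      bounded m = bound below (inPair m)
        where
        bound : (s ≻ a × s ≻ b) ⊎ (a ≡ s × s' ≻ b) → ∀ {z} → z ∈ (a ∷ b ∷ []) → s ≽ z
        bound (inj₁ (s≻a , _)) (here refl) = inj₂ s≻a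
        bound (inj₂ (a≡s , _)) (here refl) = inj₁ (sym a≡s)
        bound (inj₁ (_ , s≻b)) (there (here refl)) = inj₂ s≻b
        bound (inj₂ (_ , s'≻b)) (there (here refl)) = inj₂ (≻.trans s≻s' s'≻b)

      dominated : ∀ {y} → y ∈ Y → ∃[ x ] (x ∈ X × x ≻ y)
      dominated m = find (All.lookup dom m)

      s∈Z : s ∈ Z
      s∈Z with ∈-++⁻ Z (∈-resp-↭ pB (here refl))
      ... | inj₁ m = m
      ... | inj₂ m with dominated m
      ...   | x , x∈X , x≻s = ⊥-elim (≽⇒≯ (bounded (∈-++⁺ʳ Z x∈X)) x≻s)

      absurd : (s ≻ a × s ≻ b) ⊎ (a ≡ s × s' ≻ b) → ⊥
      absurd (inj₁ (s≻a , s≻b)) with inPair (∈-++⁺ˡ s∈Z)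
      ... | here refl = ≻.irrefl s≻a
      ... | there (here refl) = ≻.irrefl s≻b
      absurd (inj₂ (refl , s'≻b)) with ∈-++⁻ Z (∈-resp-↭ pB (there (here refl)))
      ... | inj₁ s'∈Z with inPair (∈-++⁺ˡ s'∈Z)
      ...   | here refl = ≻.irrefl s≻s'
      ...   | there (here refl) = ≻.irrefl s'≻b
      absurd (inj₂ (refl , s'≻b)) | inj₂ s'∈Y with dominated s'∈Y
      ... | x , x∈X , x≻s' with inPair (∈-++⁺ʳ Z x∈X)
      ...   | there (here refl) = ≻-asym x≻s' s'≻b
      ...   | here refl = ≻.irrefl (subst (_≻ b) (↭-pair-twice pA s∈Z x∈X) (≻.trans s≻s' s'≻b))

  PairBelow⇒≯ms : ∀ {a b s s'} → s ≻ s' → PairBelow a b s s' → ¬ (a ∷ b ∷ []) ≻ms (s ∷ s' ∷ [])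
  PairBelow⇒≯ms s≻s' (both s≻a s≻b) = ordered-PairBelow⇒≯ms s≻s' (inj₁ (s≻a , s≻b))
  PairBelow⇒≯ms s≻s' (fst a≡s s'≻b) = ordered-PairBelow⇒≯ms s≻s' (inj₂ (a≡s , s'≻b))
  PairBelow⇒≯ms s≻s' (snd b≡s s'≻a) gt =
    ordered-PairBelow⇒≯ms s≻s' (inj₂ (b≡s , s'≻a)) (≻ms-respˡ-↭ (↭-swap _ _ ↭-refl) gt)

  IsPairBelow : Term → Term → List Term → Set
  IsPairBelow s s' y = ∃[ a ] ∃[ b ] (y ≡ a ∷ b ∷ [] × PairBelow a b s s')

  ∈⇒∈-≈ : ∀ {m : List Term} {M} → m ∈ M → Any (Permutation _≡_ m) M
  ∈⇒∈-≈ = Any.map λ { refl → ↭-refl }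

  PairBelow-all⇒≱nm : ∀ {s s' M₁ M₂} → s ≻ s' → All (IsPairBelow s s') M₁ → (s ∷ s' ∷ []) ∈ M₂ →
                      ¬ (M₁ ≻nm M₂ ⊎ M₁ ≈nm M₂)
  PairBelow-all⇒≱nm s≻s' below m (inj₂ eq) with find (∈-resp-≈ (≈-sym eq) (∈⇒∈-≈ m))
  ... | y , y∈ , p with All.lookup below y∈
  ...   | a , b , refl , ab = PairBelow⇒≉ s≻s' ab (↭-sym p)
  PairBelow-all⇒≱nm {M₁ = M₁} s≻s' below m (inj₁ (Z , X , Y , pA , pB , _ , dom))
    with Any.++⁻ Z (∈-resp-≈ pB (∈⇒∈-≈ m))
  ... | inj₁ inZ with find inZ
  ...   | z , z∈ , p with find (∈-resp-≈ (≈-sym pA) (Any.++⁺ˡ (∈⇒∈-≈ z∈)))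
  ...     | y , y∈ , q with All.lookup below y∈
  ...       | a , b , refl , ab = PairBelow⇒≉ s≻s' ab (↭-sym (↭-trans p q))
  PairBelow-all⇒≱nm {M₁ = M₁} s≻s' below m (inj₁ (Z , X , Y , pA , pB , _ , dom)) | inj₂ inY with find inY
  ... | z , z∈ , p with find (All.lookup dom z∈)
  ...   | x , x∈ , x≻z with find (∈-resp-≈ (≈-sym pA) (Any.++⁺ʳ Z (∈⇒∈-≈ x∈)))
  ...     | y , y∈ , q with All.lookup below y∈
  ...       | a , b , refl , ab = PairBelow⇒≯ms s≻s' ab (≻ms-respˡ-↭ q (≻ms-respʳ-↭ (↭-sym p) x≻z))

  Decomposition : List (List Term) → List (List Term) → Set
  Decomposition A B = ∃[ Z ] ∃[ X ] ∃[ Y ] (A ≈nm Z ++ X × B ≈nm Z ++ Y × All (λ y → Any (_≻ms y) X) Y)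

  Pointwise-≽⇒Decomposition : ∀ {A B} → Pointwise (λ m m' → m ≡ m' ⊎ m ≻ms m') A B → Decomposition A B
  Pointwise-≽⇒Decomposition [] = [] , [] , [] , ≈-refl , ≈-refl , []
  Pointwise-≽⇒Decomposition (inj₁ refl ∷ ps) with Pointwise-≽⇒Decomposition ps
  ... | Z , X , Y , pA , pB , dom = _ ∷ Z , X , Y , ≈-prep _ pA , ≈-prep _ pB , dom
  Pointwise-≽⇒Decomposition (_∷_ {x = m} {y = m'} (inj₂ m≻m') ps) with Pointwise-≽⇒Decomposition ps
  ... | Z , X , Y , pA , pB , dom =
    Z , m ∷ X , m' ∷ Y , ≈-trans (≈-prep m pA) (≈-sym (shifts-≈ Z (m ∷ []))) ,
    ≈-trans (≈-prep m' pB) (≈-sym (shifts-≈ Z (m' ∷ []))) , here m≻m' ∷ All.map there dom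

  module _ {Big Small : List Term → Set} (big≻small : ∀ {x y} → Big x → Small y → x ≻ms y) where

    ≻nm-combine : ∀ {A₁ A₂ A₃ B₁ B₂ B₃ D Z₁ X₁ Y₁ Z₂ X₂ Y₂} →
      A₁ ≈nm Z₁ ++ X₁ → B₁ ≈nm Z₁ ++ Y₁ → All Small Y₁ → Any Big X₁ →
      A₂ ≈nm Z₂ ++ X₂ → B₂ ≈nm Z₂ ++ Y₂ → All Small Y₂ →
      All Small D → Decomposition A₃ B₃ →
      (A₁ ++ A₂ ++ A₃) ≻nm (B₁ ++ B₂ ++ D ++ B₃)
    ≻nm-combine {D = D} {Z₁} {X₁} {Y₁} {Z₂} {X₂} {Y₂} a₁ b₁ s₁ big a₂ b₂ s₂ sD (Z₃ , X₃ , Y₃ , a₃ , b₃ , d₃) =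
      Z₁ ++ Z₂ ++ Z₃ , X₁ ++ X₂ ++ X₃ , Y₁ ++ Y₂ ++ D ++ Y₃ ,
      ≈-trans (++⁺-≈ a₁ (++⁺-≈ a₂ a₃))
        (≈-trans (++⁺-≈ (≈-refl {Z₁ ++ X₁}) (interchange Z₂ X₂ Z₃ X₃)) (interchange Z₁ X₁ (Z₂ ++ Z₃) (X₂ ++ X₃))) ,
      ≈-trans (++⁺-≈ b₁ (++⁺-≈ b₂ (++⁺-≈ (≈-refl {D}) b₃)))
        (≈-trans (++⁺-≈ (≈-refl {Z₁ ++ Y₁}) (++⁺-≈ (≈-refl {Z₂ ++ Y₂}) (shifts-≈ D Z₃)))
        (≈-trans (++⁺-≈ (≈-refl {Z₁ ++ Y₁}) (interchange Z₂ Y₂ Z₃ (D ++ Y₃)))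
          (interchange Z₁ Y₁ (Z₂ ++ Z₃) (Y₂ ++ D ++ Y₃)))) ,
      nonempty big ,
      All.++⁺ (All.map dominated s₁) (All.++⁺ (All.map dominated s₂)
        (All.++⁺ (All.map dominated sD) (All.map (λ d → Any.++⁺ʳ X₁ (Any.++⁺ʳ X₂ d)) d₃)))
      where
      nonempty : ∀ {Xa Xb} → Any Big Xa → Xa ++ Xb ≢ []
      nonempty (here _) ()
      nonempty (there _) ()

      dominated : ∀ {y} → Small y → Any (_≻ms y) (X₁ ++ X₂ ++ X₃)
      dominated s = Any.++⁺ˡ (Any.map (λ b → big≻small b s) big)

module GroundRewriting (Sig : Signature) (_≻_ : Fol.Term Sig → Fol.Term Sig → Set)
                       (ro : Fol.IsReductionOrdering Sig _≻_) (tot : Fol.TotalOnGround Sig _≻_)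
                       (R : Fol.Term Sig → Fol.Term Sig → Set) (grs : Fol.Rewriting.GroundRS Sig R)
                       (lr : Fol.Rewriting.LeftReduced Sig R) (cont : Fol.Rewriting.ContainedIn Sig R _≻_) where
  open Signature Sig
  open Fol Sig
  open Rewriting R
  open Terms Sig
  open GroundOrder Sig _≻_ ro tot
  open SetoidPerm (setoid Term) using (↭-refl)
  open MultisetsOfMultisets Term renaming (_≈_ to _≈nm_)

  R-functional : ∀ {l r r'} → R l r → R l r' → r ≡ r'
  R-functional ρ ρ' with ≡-ground? (proj₂ (grs ρ)) (proj₂ (grs ρ'))
  ... | yes r≡r' = r≡r'
  ... | no r≢r' = ⊥-elim (lr ρ ρ' (λ { (_ , r≡r') → r≢r' r≡r' }) top)

  lhs-¬ProperSubterm : ∀ {l r l' r'} → R l r → R l' r' → ¬ ProperSubterm l' l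
  lhs-¬ProperSubterm ρ ρ' pr = lr ρ ρ' (λ { (l≡l' , _) → ProperSubterm⇒≢ pr (sym l≡l') }) (ProperSubterm⇒Subterm pr)

  -- Left-reducedness rules out overlaps between the rules.
  Repl1-overlap : ∀ {l₁ r₁ l₂ r₂ s s₁ s₂} → R l₁ r₁ → R l₂ r₂ → Repl1 l₁ r₁ s s₁ → Repl1 l₂ r₂ s s₂ →
    (l₁ ≡ l₂ × r₁ ≡ r₂ × s₁ ≡ s₂) ⊎ (∃[ s₃ ] (Repl1 l₂ r₂ s₁ s₃ × Repl1 l₁ r₁ s₂ s₃))
  Repl1-overlap ρ₁ ρ₂ here here with R-functional ρ₁ ρ₂
  ... | refl = inj₁ (refl , refl , refl)
  Repl1-overlap ρ₁ ρ₂ here (inside i q) = ⊥-elim (lhs-¬ProperSubterm ρ₁ ρ₂ (arg i (Repl1⇒Subterm q)))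
  Repl1-overlap ρ₁ ρ₂ (inside i p) here = ⊥-elim (lhs-¬ProperSubterm ρ₂ ρ₁ (arg i (Repl1⇒Subterm p)))
  Repl1-overlap ρ₁ ρ₂ (inside {f} {ts} {x₁} i p) (inside {r = x₂} j q) with i Fin.≟ j
  ... | yes refl with Repl1-overlap ρ₁ ρ₂ p q
  ...   | inj₁ (l≡ , r≡ , refl) = inj₁ (l≡ , r≡ , refl)
  ...   | inj₂ (s₃ , p' , q') = inj₂ (_ , Repl1-under ts i p' , Repl1-under ts i q')
  Repl1-overlap {l₁} {r₁} ρ₁ ρ₂ (inside {f} {ts} {x₁} i p) (inside {r = x₂} j q) | no i≢j =
    inj₂ (fun f ((ts [ i ]≔ x₁) [ j ]≔ x₂) ,
      inside-≡ j (lookup∘update′ (λ j≡i → i≢j (sym j≡i)) ts x₁) q ,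
      subst (λ z → Repl1 l₁ r₁ (fun f (ts [ j ]≔ x₂)) (fun f z)) (sym ([]≔-commutes ts i j i≢j))
        (inside-≡ i (lookup∘update′ i≢j ts x₂) p))

  Step : Term → Term → Set
  Step s s' = ∃[ l ] ∃[ r ] (R l r × Repl1 l r s s')

  Steps : Term → Term → Set
  Steps = Star Step

  Step⇒≻ : ∀ {s s'} → Step s s' → s ≻ s'
  Step⇒≻ (_ , _ , ρ , p) = ≻.monotone (cont ρ) p

  Steps⇒≽ : ∀ {s s'} → Steps s s' → s ≽ s'
  Steps⇒≽ ε = inj₁ refl
  Steps⇒≽ (st ◅ sts) = inj₂ (≻-≽-trans (Step⇒≻ st) (Steps⇒≽ sts))

  Repl1-Ground : ∀ {l r s s'} → Repl1 l r s s' → Ground s → Ground r → Ground s'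
  Repl1-Ground here _ gr = gr
  Repl1-Ground (inside {f} {ts} {x} i p) gs gr y (arg j q) with j Fin.≟ i
  ... | yes refl = Repl1-Ground p (Ground-Subterm gs (arg i top)) gr y
    (subst (Subterm (var y)) (lookup∘update i ts x) q)
  ... | no j≢i = gs y (arg j (subst (Subterm (var y)) (lookup∘update′ j≢i ts x) q))

  Steps-Ground : ∀ {s s'} → Steps s s' → Ground s → Ground s'
  Steps-Ground ε gs = gs
  Steps-Ground ((_ , _ , ρ , p) ◅ sts) gs = Steps-Ground sts (Repl1-Ground p gs (proj₂ (grs ρ)))

  Steps-under : ∀ {f x y} (ts : Vec Term (arity f)) i → Steps x y → Steps (fun f (ts [ i ]≔ x)) (fun f (ts [ i ]≔ y))
  Steps-under {f} ts i = gmap (λ x → fun f (ts [ i ]≔ x)) λ { (l , r , ρ , p) → l , r , ρ , Repl1-under ts i p }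

  Steps-at : ∀ {f} {ts : Vec Term (arity f)} i {b} → Steps (lookup ts i) b → Steps (fun f ts) (fun f (ts [ i ]≔ b))
  Steps-at {f} {ts} i {b} sts = subst (λ z → Steps (fun f z) (fun f (ts [ i ]≔ b))) ([]≔-lookup ts i)
    (Steps-under ts i sts)

  Steps-args : ∀ {f} {ts ts' : Vec Term (arity f)} → VecPW.Pointwise Steps ts ts' → Steps (fun f ts) (fun f ts')
  Steps-args {f} = go (fun f) (λ ts i → Steps-at i)
    where
    go : ∀ {n} (g : Vec Term n → Term) → (∀ ts i {b} → Steps (lookup ts i) b → Steps (g ts) (g (ts [ i ]≔ b))) →
         ∀ {ts ts'} → VecPW.Pointwise Steps ts ts' → Steps (g ts) (g ts')
    go g inner VecPW.[] = ε
    go g inner (VecPW._∷_ {x = x} {y = y} {xs = xs} sts stss) =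
      inner (x ∷ xs) zero sts ◅◅ go (λ zs → g (y ∷ zs)) (λ zs i → inner (y ∷ zs) (suc i)) stss

  fun-≻ : ∀ {f} {ts ts' : Vec Term (arity f)} → VecPW.Pointwise Steps ts ts' → ∀ i →
          lookup ts i ≻ lookup ts' i → fun f ts ≻ fun f ts'
  fun-≻ {ts = ts} stss i gt with Steps⇒≽ (Steps-args stss)
  ... | inj₁ eq = ⊥-elim (≻.irrefl (subst (λ z → lookup ts i ≻ lookup z i) (sym (fun-injectiveʳ eq)) gt))
  ... | inj₂ gt' = gt'

  module _ {θ θ' : Subst} (steps : ∀ x → Steps (θ x) (θ' x)) where
    mutual
      sub-Steps : ∀ w → Steps (sub θ w) (sub θ' w)
      sub-Steps (var x) = steps x
      sub-Steps (fun f ws) = Steps-args (subs-Steps ws)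

      subs-Steps : ∀ {n} (ws : Vec Term n) → VecPW.Pointwise Steps (subs θ ws) (subs θ' ws)
      subs-Steps [] = VecPW.[]
      subs-Steps (w ∷ ws) = sub-Steps w VecPW.∷ subs-Steps ws

    sub-≻ : ∀ {y} w → θ y ≻ θ' y → VarOf y w → sub θ w ≻ sub θ' w
    sub-≻ _ gt top = gt
    sub-≻ (fun f ws) gt (arg i p) =
      fun-≻ (subs-Steps ws) i
        (subst₂ _≻_ (sym (lookup-subs θ ws i)) (sym (lookup-subs θ' ws i)) (sub-≻ (lookup ws i) gt p))

  module _ {θ a b} (ρ : R (sub θ a) (sub θ b)) where
    mutual
      ReplAll-Steps : ∀ {c c'} → ReplAll a b c c' → Steps (sub θ c) (sub θ c')
      ReplAll-Steps hit = (_ , _ , ρ , here) ◅ ε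
      ReplAll-Steps (varR _) = ε
      ReplAll-Steps (funR _ rs) = Steps-args (ReplAlls-Steps rs)

      ReplAlls-Steps : ∀ {n} {cs cs' : Vec Term n} → ReplAlls a b cs cs' →
          VecPW.Pointwise Steps (subs θ cs) (subs θ cs')
      ReplAlls-Steps [] = VecPW.[]
      ReplAlls-Steps (r ∷ rs) = ReplAll-Steps r VecPW.∷ ReplAlls-Steps rs

    ReplAll-≻ : ∀ {c c'} → ReplAll a b c c' → Subterm a c → sub θ c ≻ sub θ c'
    ReplAll-≻ hit _ = Step⇒≻ (_ , _ , ρ , here)
    ReplAll-≻ (varR a≢x) top = ⊥-elim (a≢x refl)
    ReplAll-≻ (funR a≢c _) top = ⊥-elim (a≢c refl)
    ReplAll-≻ (funR {ts = cs} {ts' = cs'} _ rs) (arg i p) =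
      fun-≻ (ReplAlls-Steps rs) i
        (subst₂ _≻_ (sym (lookup-subs θ cs i)) (sym (lookup-subs θ cs' i)) (ReplAll-≻ (ReplAlls-lookup rs i) p))

  -- rm_R is independent of the reduction strategy: its first step commutes with any other step.
  RM-after-Step : ∀ {s n M l r s'} → RM s n M → R l r → Repl1 l r s s' →
    ∃[ M' ] (RM s' n M' × M ≈nm ((l ∷ l ∷ []) ∷ M'))
  RM-after-Step (done irr) ρ p = ⊥-elim (irr ρ p)
  RM-after-Step (step ρ₁ p₁ rest) ρ p with Repl1-overlap ρ₁ ρ p₁ p
  ... | inj₁ (refl , refl , refl) = _ , rest , ≈-refl
  ... | inj₂ (s₃ , p₁' , p') with RM-after-Step rest ρ p₁'
  ...   | M₃ , rm₃ , eq = _ , step ρ₁ p' rm₃ , ≈-trans (≈-prep _ eq) (≈-swap _ _ ≈-refl)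

  RM-after-Steps : ∀ {s s' n M} → Steps s s' → RM s n M → ∃[ M' ] RM s' n M'
  RM-after-Steps ε rm = _ , rm
  RM-after-Steps ((_ , _ , ρ , p) ◅ sts) rm = RM-after-Steps sts (proj₁ (proj₂ (RM-after-Step rm ρ p)))

  NF-after-Steps : ∀ {s s' n} → Steps s s' → NF s n → NF s' n
  NF-after-Steps sts (_ , rm) = RM-after-Steps sts rm

  RM⇒Steps : ∀ {s n M} → RM s n M → Steps s n
  RM⇒Steps (done _) = ε
  RM⇒Steps (step ρ p rest) = (_ , _ , ρ , p) ◅ RM⇒Steps rest

  RM-Irreducible : ∀ {s n M} → Irreducible s → RM s n M → n ≡ s
  RM-Irreducible _ (done _) = refl
  RM-Irreducible irr (step ρ p _) = ⊥-elim (irr ρ p)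

  Irreducible-Subterm : ∀ {s e} → Irreducible s → Subterm e s → Irreducible e
  Irreducible-Subterm irr q ρ p = irr ρ (proj₂ (Repl1-lift q p))

  Irreducible-ProperSubterm-lhs : ∀ {l r e} → R l r → ProperSubterm e l → Irreducible e
  Irreducible-ProperSubterm-lhs ρ pr ρ' p = lhs-¬ProperSubterm ρ ρ' (Subterm-ProperSubterm-trans (Repl1⇒Subterm p) pr)

  Subterm-after-Repl1 : ∀ {e s l r s₁} → Subterm e s → Repl1 l r s s₁ →
    (∃[ e₁ ] (Subterm e₁ s₁ × Repl1 l r e e₁)) ⊎ Subterm e s₁ ⊎ ProperSubterm e l
  Subterm-after-Repl1 top p = inj₁ (_ , top , p)
  Subterm-after-Repl1 (arg i q) here = inj₂ (inj₂ (arg i q))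
  Subterm-after-Repl1 (arg {f} {ts} i q) (inside {r = x} j p) with i Fin.≟ j
  ... | no i≢j = inj₂ (inj₁ (arg i (subst (Subterm _) (sym (lookup∘update′ i≢j ts x)) q)))
  ... | yes refl with Subterm-after-Repl1 q p
  ...   | inj₁ (e₁ , q' , p') = inj₁ (e₁ , arg i (subst (Subterm e₁) (sym (lookup∘update i ts x)) q') , p')
  ...   | inj₂ (inj₁ q') = inj₂ (inj₁ (arg i (subst (Subterm _) (sym (lookup∘update i ts x)) q')))
  ...   | inj₂ (inj₂ pr) = inj₂ (inj₂ pr)

  Normalizable : Term → Set
  Normalizable s = ∃[ n ] ∃[ M ] RM s n M

  Normalizable-Subterm : ∀ {s n M e} → RM s n M → Subterm e s → Normalizable e
  Normalizable-Subterm (done irr) q = _ , _ , done (Irreducible-Subterm irr q)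
  Normalizable-Subterm (step ρ p rest) q with Subterm-after-Repl1 q p
  ... | inj₁ (e₁ , q' , p') with Normalizable-Subterm rest q'
  ...   | n , M , rm = n , _ , step ρ p' rm
  Normalizable-Subterm (step ρ p rest) q | inj₂ (inj₁ q') = Normalizable-Subterm rest q'
  Normalizable-Subterm (step ρ p rest) q | inj₂ (inj₂ pr) = _ , _ , done (Irreducible-ProperSubterm-lhs ρ pr)

  DoubleBelow : Term → List Term → Set
  DoubleBelow s m = ∃[ l ] (m ≡ l ∷ l ∷ [] × s ≽ l)

  RM-bounded : ∀ {s n M} → Ground s → RM s n M → s ≽ n × All (DoubleBelow s) M
  RM-bounded gs (done _) = inj₁ refl , []
  RM-bounded gs (step ρ p rest) with RM-bounded (Repl1-Ground p gs (proj₂ (grs ρ))) rest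
  ... | s'≽n , below =
    ≽-trans (inj₂ s≻s') s'≽n ,
    (_ , refl , Subterm⇒≽ gs (Repl1⇒Subterm p)) ∷ All.map
      (λ { (l , eq , s'≽l) → l , eq , ≽-trans (inj₂ s≻s') s'≽l }) below
    where
    s≻s' : _ ≻ _
    s≻s' = ≻.monotone (cont ρ) p

  NF-Irreducible-args : ∀ {n} {ts ns : Vec Term n} → VecPW.Pointwise NF ts ns →
      (∀ i → Irreducible (lookup ts i)) → ns ≡ ts
  NF-Irreducible-args VecPW.[] _ = refl
  NF-Irreducible-args ((_ , rm) VecPW.∷ nfs) irr = cong₂ _∷_ (RM-Irreducible (irr zero) rm)
    (NF-Irreducible-args nfs (λ i → irr (suc i)))

Enumerates-deduplicate : ∀ {A : Set} (_≟_ : DecidableEquality A) (P : A → Set) (L : List A) →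
  (∀ s → s ∈ L → P s) → (∀ s → P s → s ∈ L) → Enumerates P (deduplicate _≟_ L)
Enumerates-deduplicate _≟_ P L sound complete =
  Unique.deduplicate-! _≟_ L ,
  (λ s m → sound s (∈-deduplicate⁻ _≟_ L m)) ,
  (λ s p → ∈-deduplicate⁺ _≟_ (complete s p))

-- The signature carries no decidable equality of symbols; it is recovered from the totality of ≻ on
-- ground terms, by comparing f(g,…,g) with f'(g,…,g) for some ground term g.
module Enumeration (Sig : Signature) (_≻_ : Fol.Term Sig → Fol.Term Sig → Set)
                   (ro : Fol.IsReductionOrdering Sig _≻_) (tot : Fol.TotalOnGround Sig _≻_)
                   (g : Fol.Term Sig) (gg : Fol.Ground Sig g) where
  open Signature Sig
  open Fol Sig
  open Terms Sig
  module ≻ = IsReductionOrdering ro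

  constant : Fun → Term
  constant f = fun f (replicate (arity f) g)

  constant-Ground : ∀ f → Ground (constant f)
  constant-Ground f x (arg i q) = gg x (subst (Subterm (var x)) (lookup-replicate i g) q)

  _≟ᶠ_ : DecidableEquality Fun
  f ≟ᶠ f' with tot (constant-Ground f) (constant-Ground f')
  ... | inj₁ eq = yes (fun-injectiveˡ eq)
  ... | inj₂ (inj₁ gt) = no λ { refl → ≻.irrefl gt }
  ... | inj₂ (inj₂ lt) = no λ { refl → ≻.irrefl lt }

  mutual
    _≟ₜ_ : DecidableEquality Term
    var x ≟ₜ var y with x ℕ.≟ y
    ... | yes refl = yes refl
    ... | no x≢y = no λ { refl → x≢y refl }
    var x ≟ₜ fun f ts = no λ ()
    fun f ts ≟ₜ var x = no λ ()
    fun f ts ≟ₜ fun f' us with f ≟ᶠ f'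
    ... | no f≢f' = no λ eq → f≢f' (fun-injectiveˡ eq)
    ... | yes refl with ts ≟ᵥ us
    ...   | yes refl = yes refl
    ...   | no ts≢us = no λ eq → ts≢us (fun-injectiveʳ eq)

    _≟ᵥ_ : ∀ {n} → DecidableEquality (Vec Term n)
    [] ≟ᵥ [] = yes refl
    (x ∷ xs) ≟ᵥ (y ∷ ys) with x ≟ₜ y | xs ≟ᵥ ys
    ... | yes refl | yes refl = yes refl
    ... | no x≢y | _ = no λ { refl → x≢y refl }
    ... | _ | no xs≢ys = no λ { refl → xs≢ys refl }

  mutual
    subterms : Term → List Term
    subterms (var x) = var x ∷ []
    subterms (fun f ts) = fun f ts ∷ subtermsᵥ ts

    subtermsᵥ : ∀ {n} → Vec Term n → List Term
    subtermsᵥ [] = []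
    subtermsᵥ (t ∷ ts) = subterms t ++ subtermsᵥ ts

  mutual
    subterms-sound : ∀ {e} s → e ∈ subterms s → Subterm e s
    subterms-sound (var x) (here refl) = top
    subterms-sound (fun f ts) (here refl) = top
    subterms-sound (fun f ts) (there m) with subtermsᵥ-sound ts m
    ... | i , q = arg i q

    subtermsᵥ-sound : ∀ {e n} (ts : Vec Term n) → e ∈ subtermsᵥ ts → ∃[ i ] Subterm e (lookup ts i)
    subtermsᵥ-sound (t ∷ ts) m with ∈-++⁻ (subterms t) m
    ... | inj₁ m' = zero , subterms-sound t m'
    ... | inj₂ m' with subtermsᵥ-sound ts m'
    ...   | i , q = suc i , q

  mutual
    subterms-complete : ∀ {e s} → Subterm e s → e ∈ subterms s
    subterms-complete {s = var x} top = here refl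
    subterms-complete {s = fun f ts} top = here refl
    subterms-complete (arg {ts = ts} i q) = there (subtermsᵥ-complete ts i q)

    subtermsᵥ-complete : ∀ {e n} (ts : Vec Term n) i → Subterm e (lookup ts i) → e ∈ subtermsᵥ ts
    subtermsᵥ-complete (t ∷ ts) zero q = ∈-++⁺ˡ (subterms-complete q)
    subtermsᵥ-complete (t ∷ ts) (suc i) q = ∈-++⁺ʳ (subterms t) (subtermsᵥ-complete ts i q)

  subtermsₗ : List Term → List Term
  subtermsₗ [] = []
  subtermsₗ (a ∷ as) = subterms a ++ subtermsₗ as

  subtermsₗ-sound : ∀ as {e} → e ∈ subtermsₗ as → ∃[ a ] (a ∈ as × Subterm e a)
  subtermsₗ-sound (a ∷ as) m with ∈-++⁻ (subterms a) m
  ... | inj₁ m' = a , here refl , subterms-sound a m'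
  ... | inj₂ m' with subtermsₗ-sound as m'
  ...   | a' , a'∈ , q = a' , there a'∈ , q

  subtermsₗ-complete : ∀ as {a e} → a ∈ as → Subterm e a → e ∈ subtermsₗ as
  subtermsₗ-complete (a ∷ as) (here refl) q = ∈-++⁺ˡ (subterms-complete q)
  subtermsₗ-complete (a ∷ as) (there m) q = ∈-++⁺ʳ (subterms a) (subtermsₗ-complete as m q)

  negSides : Clause → List Term
  negSides [] = []
  negSides (pos _ _ ∷ E) = negSides E
  negSides (neg a b ∷ E) = a ∷ b ∷ negSides E

  negSides-sound : ∀ E {s} → s ∈ negSides E → ∃[ a ] ∃[ b ] (neg a b ∈ E × (s ≡ a ⊎ s ≡ b))
  negSides-sound (pos _ _ ∷ E) m with negSides-sound E m
  ... | a , b , m' , side = a , b , there m' , side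
  negSides-sound (neg a b ∷ E) (here refl) = a , b , here refl , inj₁ refl
  negSides-sound (neg a b ∷ E) (there (here refl)) = a , b , here refl , inj₂ refl
  negSides-sound (neg _ _ ∷ E) (there (there m)) with negSides-sound E m
  ... | a , b , m' , side = a , b , there m' , side

  negSides-complete : ∀ E {a b} → neg a b ∈ E → a ∈ negSides E × b ∈ negSides E
  negSides-complete (pos _ _ ∷ E) (there m) = negSides-complete E m
  negSides-complete (neg a b ∷ E) (here refl) = here refl , there (here refl)
  negSides-complete (neg _ _ ∷ E) (there m) with negSides-complete E m
  ... | a∈ , b∈ = there (there a∈) , there (there b∈)

  ts⁻ : Clause → List Term
  ts⁻ E = deduplicate _≟ₜ_ (negSides E)

  ss⁻ : Clause → List Term
  ss⁻ E = deduplicate _≟ₜ_ (subtermsₗ (negSides E))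

  module _ (R : Term → Term → Set) where
    open Rewriting R

    ss⁻-Enumerates : ∀ E → Enumerates (InSS E) (ss⁻ E)
    ss⁻-Enumerates E = Enumerates-deduplicate _≟ₜ_ (InSS E) _ sound complete
      where
      sound : ∀ s → s ∈ subtermsₗ (negSides E) → InSS E s
      sound s m with subtermsₗ-sound (negSides E) m
      ... | _ , a∈ , q with negSides-sound E a∈
      ...   | a , b , m' , inj₁ refl = a , b , m' , inj₁ q
      ...   | a , b , m' , inj₂ refl = a , b , m' , inj₂ q
      complete : ∀ s → InSS E s → s ∈ subtermsₗ (negSides E)
      complete s (a , b , m , inj₁ q) = subtermsₗ-complete (negSides E) (proj₁ (negSides-complete E m)) q
      complete s (a , b , m , inj₂ q) = subtermsₗ-complete (negSides E) (proj₂ (negSides-complete E m)) q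

    ts⁻-Enumerates : ∀ E → Enumerates (InTS E) (ts⁻ E)
    ts⁻-Enumerates E = Enumerates-deduplicate _≟ₜ_ (InTS E) _ (λ s → negSides-sound E) complete
      where
      complete : ∀ s → InTS E s → s ∈ negSides E
      complete s (a , b , m , inj₁ refl) = proj₁ (negSides-complete E m)
      complete s (a , b , m , inj₂ refl) = proj₂ (negSides-complete E m)

Pointwise-∈ˡ : ∀ {A B : Set} {P : A → B → Set} {S Ms c} → Pointwise P S Ms → c ∈ S → ∃[ M ] P c M
Pointwise-∈ˡ (r ∷ _) (here refl) = _ , r
Pointwise-∈ˡ (_ ∷ rs) (there m) = Pointwise-∈ˡ rs m

Pointwise-∈ʳ : ∀ {A B : Set} {P : A → B → Set} {S Ms M} → Pointwise P S Ms → M ∈ Ms → ∃[ c ] (c ∈ S × P c M)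
Pointwise-∈ʳ (r ∷ _) (here refl) = _ , here refl , r
Pointwise-∈ʳ (_ ∷ rs) (there m) with Pointwise-∈ʳ rs m
... | c , c∈ , p = c , there c∈ , p

Pointwise-build : ∀ {A B : Set} {P : A → B → Set} (S : List A) → (∀ c → c ∈ S → ∃[ M ] P c M) → ∃[ Ms ] Pointwise P S Ms
Pointwise-build [] _ = [] , []
Pointwise-build (c ∷ S) h with h c (here refl) | Pointwise-build S (λ c' m → h c' (there m))
... | M , p | Ms , pw = M ∷ Ms , p ∷ pw

module ClauseMultisets (Sig : Signature) (_≻_ : Fol.Term Sig → Fol.Term Sig → Set)
                       (ro : Fol.IsReductionOrdering Sig _≻_) (tot : Fol.TotalOnGround Sig _≻_)
                       (R : Fol.Term Sig → Fol.Term Sig → Set) (grs : Fol.Rewriting.GroundRS Sig R)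
                       (lr : Fol.Rewriting.LeftReduced Sig R) (cont : Fol.Rewriting.ContainedIn Sig R _≻_) where
  open Signature Sig
  open Fol Sig
  open Rewriting R
  open Terms Sig
  open GroundOrder Sig _≻_ ro tot
  open GroundRewriting Sig _≻_ ro tot R grs lr cont
  open SetoidPerm (setoid Term) using (_↭_; ↭-sym)
  open MultisetsOfMultisets Term renaming (_≈_ to _≈nm_)

  ∈-subC : ∀ {θ E L x} → L ∈ E → VarOfL x (subL θ L) → VarOfC x (subC θ E)
  ∈-subC (here refl) v = here v
  ∈-subC (there m) v = there (∈-subC m v)

  Ground-pos-sides : ∀ {E a b} θ → GroundC (subC θ E) → pos a b ∈ E → Ground (sub θ a) × Ground (sub θ b)
  Ground-pos-sides θ g m = (λ x v → g x (∈-subC m (inj₁ v))) , (λ x v → g x (∈-subC m (inj₂ v)))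

  Ground-neg-sides : ∀ {E a b} θ → GroundC (subC θ E) → neg a b ∈ E → Ground (sub θ a) × Ground (sub θ b)
  Ground-neg-sides θ g m = (λ x v → g x (∈-subC m (inj₁ v))) , (λ x v → g x (∈-subC m (inj₂ v)))

  posPart-++ : ∀ θ A B → posPart θ (A ++ B) ≡ posPart θ A ++ posPart θ B
  posPart-++ θ [] B = refl
  posPart-++ θ (pos a b ∷ A) B = cong (_ ∷_) (posPart-++ θ A B)
  posPart-++ θ (neg a b ∷ A) B = posPart-++ θ A B

  posPart-subC : ∀ θ σ A → posPart θ (subC σ A) ≡ posPart (θ ∘ₛ σ) A
  posPart-subC θ σ [] = refl
  posPart-subC θ σ (pos a b ∷ A) =
    cong₂ _∷_ (cong₂ (λ x y → x ∷ y ∷ []) (sub-∘ θ σ a) (sub-∘ θ σ b)) (posPart-subC θ σ A)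
  posPart-subC θ σ (neg a b ∷ A) = posPart-subC θ σ A

  posPart-ext : ∀ {θ₁ θ₂} A → (∀ x → VarOfC x A → θ₁ x ≡ θ₂ x) → posPart θ₁ A ≡ posPart θ₂ A
  posPart-ext [] h = refl
  posPart-ext (pos a b ∷ A) h =
    cong₂ _∷_ (cong₂ (λ x y → x ∷ y ∷ []) (sub-ext a λ x v → h x (here (inj₁ v)))
      (sub-ext b λ x v → h x (here (inj₂ v))))
      (posPart-ext A λ x v → h x (there v))
  posPart-ext (neg a b ∷ A) h = posPart-ext A λ x v → h x (there v)

  posPart-∈⁻ : ∀ {θ y} A → y ∈ posPart θ A → ∃[ a ] ∃[ b ] (pos a b ∈ A × y ≡ sub θ a ∷ sub θ b ∷ [])
  posPart-∈⁻ (pos a b ∷ A) (here refl) = a , b , here refl , refl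
  posPart-∈⁻ (pos _ _ ∷ A) (there m) with posPart-∈⁻ A m
  ... | a , b , m' , eq = a , b , there m' , eq
  posPart-∈⁻ (neg _ _ ∷ A) m with posPart-∈⁻ A m
  ... | a , b , m' , eq = a , b , there m' , eq

  posPart-∈⁺ : ∀ {θ a b} A → pos a b ∈ A → (sub θ a ∷ sub θ b ∷ []) ∈ posPart θ A
  posPart-∈⁺ (pos _ _ ∷ A) (here refl) = here refl
  posPart-∈⁺ (pos _ _ ∷ A) (there m) = there (posPart-∈⁺ A m)
  posPart-∈⁺ (neg _ _ ∷ A) (there m) = posPart-∈⁺ A m

  args-Steps : ∀ {θ n} {es ns : Vec Term n} → VecPW.Pointwise (λ a m → NF (sub θ a) m) es ns →
               VecPW.Pointwise Steps (subs θ es) ns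
  args-Steps VecPW.[] = VecPW.[]
  args-Steps ((_ , rm) VecPW.∷ nfs) = RM⇒Steps rm VecPW.∷ args-Steps nfs

  args-NF-subs : ∀ {θ n} {es ns : Vec Term n} → VecPW.Pointwise (λ a m → NF (sub θ a) m) es ns →
                 VecPW.Pointwise NF (subs θ es) ns
  args-NF-subs VecPW.[] = VecPW.[]
  args-NF-subs (nf VecPW.∷ nfs) = nf VecPW.∷ args-NF-subs nfs

  SSContrib-bounded : ∀ {θ e M} → Ground (sub θ e) → SSContrib θ e M → All (DoubleBelow (sub θ e)) M
  SSContrib-bounded g (cvar rm) = proj₂ (RM-bounded g rm)
  SSContrib-bounded g (cfun nfs rm) =
    All.map (λ { (l , eq , b) → l , eq , ≽-trans (Steps⇒≽ sts) b }) (proj₂ (RM-bounded (Steps-Ground sts g) rm))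
    where
    sts : Steps _ _
    sts = Steps-args (args-Steps nfs)

  TSContrib-bounded : ∀ {θ a m} → Ground (sub θ a) → TSContrib θ a m → ∃[ n ] (m ≡ n ∷ n ∷ [] × sub θ a ≽ n)
  TSContrib-bounded g (n , (_ , rm) , eq) = n , eq , proj₁ (RM-bounded g rm)

  args-NF : ∀ {θ n} (es : Vec Term n) → (∀ i → Normalizable (lookup (subs θ es) i)) →
            Σ (Vec Term n) λ ns → VecPW.Pointwise (λ a m → NF (sub θ a) m) es ns
  args-NF [] _ = [] , VecPW.[]
  args-NF (e ∷ es) h with h zero | args-NF es (λ i → h (suc i))
  ... | n , M , rm | ns , nfs = n ∷ ns , (M , rm) VecPW.∷ nfs

  SSContrib-exists : ∀ θ e → Normalizable (sub θ e) → ∃[ M ] SSContrib θ e M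
  SSContrib-exists θ (var x) (n , M , rm) = M , cvar rm
  SSContrib-exists θ (fun f es) (n , M , rm) with args-NF {θ} es (λ i → Normalizable-Subterm rm (arg i top))
  ... | ns , nfs = _ , cfun nfs (proj₂ (RM-after-Steps (Steps-args (args-Steps nfs)) rm))

  TSContrib-exists : ∀ θ a → Normalizable (sub θ a) → ∃[ m ] TSContrib θ a m
  TSContrib-exists θ a (n , M , rm) = _ , n , (M , rm) , refl

  record NMWitness (E : Clause) (θ : Subst) : Set where
    field
      ss-list ts-list : List Term
      ss-contribs : List (List (List Term))
      ts-contribs : List (List Term)
      ss-enum : Enumerates (InSS E) ss-list
      ts-enum : Enumerates (InTS E) ts-list
      ss-pw : Pointwise (SSContrib θ) ss-list ss-contribs
      ts-pw : Pointwise (TSContrib θ) ts-list ts-contribs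

  open NMWitness public

  nm : ∀ {E θ} → NMWitness E θ → List (List Term)
  nm {E} {θ} w = concat (ss-contribs w) ++ ts-contribs w ++ posPart θ E

  NMWitness⇒NM : ∀ {E θ} (w : NMWitness E θ) → NM (E , θ) (nm w)
  NMWitness⇒NM record { ss-enum = se ; ts-enum = te ; ss-pw = sp ; ts-pw = tp } = _ , _ , _ , _ , se , te , sp ,
    tp , refl

  NM⇒NMWitness : ∀ {E θ M} → NM (E , θ) M → Σ (NMWitness E θ) λ w → M ≡ nm w
  NM⇒NMWitness (_ , _ , _ , _ , se , te , sp , tp , refl) =
    record { ss-enum = se ; ts-enum = te ; ss-pw = sp ; ts-pw = tp } , refl

  posPart-∈-nm : ∀ {E θ a b} (w : NMWitness E θ) → pos a b ∈ E → (sub θ a ∷ sub θ b ∷ []) ∈ nm w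
  posPart-∈-nm {E} w m = ∈-++⁺ʳ (concat (ss-contribs w)) (∈-++⁺ʳ (ts-contribs w) (posPart-∈⁺ E m))

  ∈-nm⁻ : ∀ {E θ y} (w : NMWitness E θ) → y ∈ nm w →
    (∃[ c ] (InSS E c × ∃[ M ] (SSContrib θ c M × y ∈ M))) ⊎
    (∃[ c ] (InTS E c × TSContrib θ c y)) ⊎
    (∃[ a ] ∃[ b ] (pos a b ∈ E × y ≡ sub θ a ∷ sub θ b ∷ []))
  ∈-nm⁻ {E} w y∈ with ∈-++⁻ (concat (ss-contribs w)) y∈
  ... | inj₁ y∈ss with find (∈-concat⁻ (ss-contribs w) y∈ss)
  ...   | M , M∈ , y∈M with Pointwise-∈ʳ (ss-pw w) M∈
  ...     | c , c∈ , contrib = inj₁ (c , proj₁ (proj₂ (ss-enum w)) c c∈ , M , contrib , y∈M)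
  ∈-nm⁻ {E} w y∈ | inj₂ y∈' with ∈-++⁻ (ts-contribs w) y∈'
  ... | inj₁ y∈ts with Pointwise-∈ʳ (ts-pw w) y∈ts
  ...   | c , c∈ , contrib = inj₂ (inj₁ (c , proj₁ (proj₂ (ts-enum w)) c c∈ , contrib))
  ∈-nm⁻ {E} w y∈ | inj₂ y∈' | inj₂ y∈pos = inj₂ (inj₂ (posPart-∈⁻ E y∈pos))

  InTS⇒InSS : ∀ {E e} → InTS E e → InSS E e
  InTS⇒InSS (a , b , m , inj₁ refl) = a , b , m , inj₁ top
  InTS⇒InSS (a , b , m , inj₂ refl) = a , b , m , inj₂ top

  SideBelow : Term → Term → Set
  SideBelow s u = Ground u × Normalizable u × s ≻ u

  NegSidesBelow : Clause → Subst → Term → Set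
  NegSidesBelow E θ s = ∀ {a b} → neg a b ∈ E → SideBelow s (sub θ a) × SideBelow s (sub θ b)

  module _ {E θ s} (below : NegSidesBelow E θ s) where

    InSS⇒SideBelow : ∀ {c} → InSS E c → SideBelow s (sub θ c)
    InSS⇒SideBelow (a , b , m , side) = subterm-below side (below m)
      where
      subterm-below : ∀ {c} → Subterm c a ⊎ Subterm c b → SideBelow s (sub θ a) × SideBelow s (sub θ b) →
          SideBelow s (sub θ c)
      subterm-below (inj₁ q) ((ga , (_ , _ , rm) , s≻a) , _) =
        Ground-Subterm ga (Subterm-sub θ q) , Normalizable-Subterm rm (Subterm-sub θ q) ,
          ≻-≽-trans s≻a (Subterm⇒≽ ga (Subterm-sub θ q))
      subterm-below (inj₂ q) (_ , (gb , (_ , _ , rm) , s≻b)) =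
        Ground-Subterm gb (Subterm-sub θ q) , Normalizable-Subterm rm (Subterm-sub θ q) ,
          ≻-≽-trans s≻b (Subterm⇒≽ gb (Subterm-sub θ q))

    InTS⇒SideBelow : ∀ {c} → InTS E c → SideBelow s (sub θ c)
    InTS⇒SideBelow (a , b , m , inj₁ refl) = proj₁ (below m)
    InTS⇒SideBelow (a , b , m , inj₂ refl) = proj₂ (below m)

  module _ (E : Clause) (θ : Subst) {s s'} (s≻s' : s ≻ s') (gs : Ground s) (neg-below : NegSidesBelow E θ s)
           (pos-below : ∀ {a b} → pos a b ∈ E → PairBelow (sub θ a) (sub θ b) s s') where
    open Enumeration Sig _≻_ ro tot s gs

    private
      witness : NMWitness E θ
      witness = record
        { ss-enum = ss⁻-Enumerates R E
        ; ts-enum = ts⁻-Enumerates R E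
        ; ss-pw = proj₂ (Pointwise-build (ss⁻ E) λ c m →
            SSContrib-exists θ c
              (proj₁ (proj₂ (InSS⇒SideBelow {E} {θ} {s} neg-below (proj₁ (proj₂ (ss⁻-Enumerates R E)) c m)))))
        ; ts-pw = proj₂ (Pointwise-build (ts⁻ E) λ c m →
            TSContrib-exists θ c
              (proj₁ (proj₂ (InTS⇒SideBelow {E} {θ} {s} neg-below (proj₁ (proj₂ (ts⁻-Enumerates R E)) c m)))))
        }

      double-below : ∀ {l} → s ≻ l → (s ∷ s' ∷ []) ≻ms (l ∷ l ∷ [])
      double-below s≻l = PairBelow⇒≻ms (both s≻l s≻l)

      below-pair : ∀ {y} → y ∈ nm witness → (s ∷ s' ∷ []) ≻ms y
      below-pair y∈ with ∈-nm⁻ witness y∈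
      ... | inj₁ (c , c∈ , M , contrib , y∈M) with InSS⇒SideBelow {E} {θ} {s} neg-below c∈
      ...   | gc , _ , s≻c with All.lookup (SSContrib-bounded gc contrib) y∈M
      ...     | l , refl , c≽l = double-below (≻-≽-trans s≻c c≽l)
      below-pair y∈ | inj₂ (inj₁ (c , c∈ , contrib)) with InTS⇒SideBelow {E} {θ} {s} neg-below c∈
      ... | gc , _ , s≻c with TSContrib-bounded {θ = θ} {a = c} gc contrib
      ...   | n , refl , c≽n = double-below (≻-≽-trans s≻c c≽n)
      below-pair y∈ | inj₂ (inj₂ (a , b , m , refl)) = PairBelow⇒≻ms (pos-below m)

    nm-below-pair : ∀ {M₁ m} → m ∈ M₁ → m ↭ (s ∷ s' ∷ []) → ∃[ M₂ ] (NM (E , θ) M₂ × M₁ ≻nm M₂)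
    nm-below-pair {M₁} {m} m∈ m↭ =
      nm witness , NMWitness⇒NM witness ,
      [] , M₁ , nm witness , ≈-refl , ≈-refl , nonempty m∈ ,
      All.tabulate (λ y∈ → Any.map (λ { refl → ≻ms-respˡ-↭ (↭-sym m↭) (below-pair y∈) }) m∈)
      where
      nonempty : ∀ {X : List (List Term)} → m ∈ X → X ≢ []
      nonempty (here _) ()
      nonempty (there _) ()

  NMWitness-Normalizable : ∀ {E θ a b} (w : NMWitness E θ) → neg a b ∈ E →
      Normalizable (sub θ a) × Normalizable (sub θ b)
  NMWitness-Normalizable {θ = θ} {a} {b} w m =
    normalizable {c = a} (Pointwise-∈ˡ (ts-pw w) (proj₂ (proj₂ (ts-enum w)) a (a , b , m , inj₁ refl))) ,
    normalizable {c = b} (Pointwise-∈ˡ (ts-pw w) (proj₂ (proj₂ (ts-enum w)) b (a , b , m , inj₂ refl)))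
    where
    normalizable : ∀ {c} → ∃[ m ] TSContrib θ c m → Normalizable (sub θ c)
    normalizable (_ , n , (M , rm) , _) = n , M , rm

  SideBelow-Steps : ∀ {s u u'} → Steps u u' → SideBelow s u → SideBelow s u'
  SideBelow-Steps sts (ga , (n , _ , rm) , s≻a) =
    Steps-Ground sts ga , (n , RM-after-Steps sts rm) , ≻-≽-trans s≻a (Steps⇒≽ sts)

  SideBelow-≽ : ∀ {s s₀ u} → s ≽ s₀ → SideBelow s₀ u → SideBelow s u
  SideBelow-≽ s≽s₀ (ga , na , s₀≻a) = ga , na , ≽-≻-trans s≽s₀ s₀≻a

module Inferences (Sig : Signature) (_≻_ : Fol.Term Sig → Fol.Term Sig → Set)
                  (ro : Fol.IsReductionOrdering Sig _≻_) (tot : Fol.TotalOnGround Sig _≻_)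
                  (R : Fol.Term Sig → Fol.Term Sig → Set) (grs : Fol.Rewriting.GroundRS Sig R)
                  (lr : Fol.Rewriting.LeftReduced Sig R) (cont : Fol.Rewriting.ContainedIn Sig R _≻_) where
  open Signature Sig
  open Fol Sig
  open Rewriting R
  open Orders _≻_
  open Terms Sig
  open GroundOrder Sig _≻_ ro tot
  open GroundRewriting Sig _≻_ ro tot R grs lr cont
  open ClauseMultisets Sig _≻_ ro tot R grs lr cont
  open SetoidPerm (setoid Term) using (_↭_; ↭-refl; ↭-sym; ↭-trans; ↭-swap)
  open SetoidPermProps (setoid Term) using (∈-resp-↭; xs↭ys⇒|xs|≡|ys|; map⁺)
  open MultisetsOfMultisets Term renaming (_≈_ to _≈nm_)

  LiteralSetoid : Setoid 0ℓ 0ℓ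
  LiteralSetoid = record
    { Carrier = Literal ; _≈_ = _≈L_ ; isEquivalence = record { refl = ↭-refl ; sym = ↭-sym ; trans = ↭-trans } }

  open SetoidPermProps LiteralSetoid using () renaming (∈-resp-↭ to ∈-resp-≈C)

  img-subL : ∀ σ L → img (subL σ L) ≡ map (sub σ) (img L)
  img-subL σ (pos a b) = refl
  img-subL σ (neg a b) = refl

  subL-≈L : ∀ σ {L L'} → L ≈L L' → img (subL σ L) ↭ img (subL σ L')
  subL-≈L σ {L} {L'} p = subst₂ _↭_ (sym (img-subL σ L)) (sym (img-subL σ L')) (map⁺ (setoid Term) (cong (sub σ)) p)

  pos≉neg : ∀ {a b c d} → ¬ (pos a b ≈L neg c d)
  pos≉neg p with xs↭ys⇒|xs|≡|ys| p
  ... | ()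

  ∈-≈C : ∀ {L E rest} → E ≈C (L ∷ rest) → ∃[ L' ] (L' ∈ E × L ≈L L')
  ∈-≈C {L} E≈ = find (∈-resp-≈C (SetoidPerm.↭-sym LiteralSetoid E≈) (here ↭-refl))

  ∈-≈C-pos : ∀ {s s' E rest} → E ≈C (pos s s' ∷ rest) →
      ∃[ a ] ∃[ b ] (pos a b ∈ E × ((a ≡ s × b ≡ s') ⊎ (a ≡ s' × b ≡ s)))
  ∈-≈C-pos E≈ with ∈-≈C E≈
  ... | pos a b , m , p = a , b , m , ↭-pair⁻ (↭-sym p)
  ... | neg a b , m , p = ⊥-elim (pos≉neg p)

  ∈-≈C-neg : ∀ {s s' E rest} → E ≈C (neg s s' ∷ rest) → ∃[ a ] ∃[ b ] (neg a b ∈ E × (s ≡ a ⊎ s ≡ b))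
  ∈-≈C-neg E≈ with ∈-≈C E≈
  ... | pos a b , m , p = ⊥-elim (pos≉neg (↭-sym p))
  ... | neg a b , m , p with ∈-resp-↭ p (here refl)
  ...   | here s≡ = a , b , m , inj₁ s≡
  ...   | there (here s≡) = a , b , m , inj₁ s≡
  ...   | there (there (here s≡)) = a , b , m , inj₂ s≡
  ...   | there (there (there (here s≡))) = a , b , m , inj₂ s≡

  pos-injective : ∀ {a b a' b'} → pos a b ≡ pos a' b' → a ≡ a' × b ≡ b'
  pos-injective refl = refl , refl

  neg-injective : ∀ {a b a' b'} → neg a b ≡ neg a' b' → a ≡ a' × b ≡ b'
  neg-injective refl = refl , refl

  module Premises (D' : Clause) (t t' : Term) (C : Clause) (θ : Subst)
                  (ground-P : GroundC (subC θ (pos t t' ∷ D'))) (ground-C : GroundC (subC θ C))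
                  (left : Inference.LeftCond _≻_ θ D' t t') (ρ : R (sub θ t) (sub θ t'))
                  (wC : NMWitness C θ) (wP : NMWitness (pos t t' ∷ D') θ)
                  (C≽P : nm wC ≻nm nm wP ⊎ nm wC ≈nm nm wP) where
    T T' : Term
    T = sub θ t
    T' = sub θ t'

    T≻T' : T ≻ T'
    T≻T' = proj₂ left

    gT : Ground T
    gT = proj₁ (grs ρ)

    gT' : Ground T'
    gT' = proj₂ (grs ρ)

    TT'∈nmP : (T ∷ T' ∷ []) ∈ nm wP
    TT'∈nmP = posPart-∈-nm wP (here refl)

    D'-pos-below : ∀ {a b} → pos a b ∈ D' → PairBelow (sub θ a) (sub θ b) T T'
    D'-pos-below m with All.lookup (proj₁ left) m | Ground-pos-sides {pos t t' ∷ D'} θ ground-P (there m)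
    ... | ≯ , ≉ | ga , gb = ≯ms⇒PairBelow {T} {T'} gT gT' T≻T' ga gb ≯ ≉

    D'-neg-below : NegSidesBelow D' θ T
    D'-neg-below m with All.lookup (proj₁ left) m | Ground-neg-sides {pos t t' ∷ D'} θ ground-P (there m) |
      NMWitness-Normalizable wP (there m)
    ... | ≯ , _ | ga , gb | na , nb with ≯ms⇒neg-below {T} {T'} gT gT' T≻T' ga gb ≯
    ...   | T≻a , T≻b = (ga , na , T≻a) , (gb , nb , T≻b)

    module _ (θ* : Subst) (w : Term) where
      Descends : Term → Term → Set
      Descends a a* = Steps (sub θ a) (sub θ* a*) × (Subterm w a → sub θ a ≻ sub θ* a*)

      LiteralDescends : Literal → Literal → Set
      LiteralDescends (pos a b) (pos a* b*) = Descends a a* × Descends b b*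
      LiteralDescends (neg a b) (neg a* b*) = Descends a a* × Descends b b*
      LiteralDescends _ _ = ⊥

      Origin : Literal → Set
      Origin L* = (∃[ L ] (L ∈ D' × subL θ* L* ≡ subL θ L)) ⊎ (∃[ L ] (L ∈ C × LiteralDescends L L*))

    module PositiveMain (s s' : Term) (rest : Clause) (s≻s' : sub θ s ≻ sub θ s')
                        (C≈ : C ≈C (pos s s' ∷ rest)) (smax : StrictMaxRest θ (pos s s') rest)
                        (w : Term) (w⊴s : Subterm w s) (T⊴s : Subterm T (sub θ s)) where
      S S' : Term
      S = sub θ s
      S' = sub θ s'

      main : ∃[ a ] ∃[ b ] (pos a b ∈ C × ((a ≡ s × b ≡ s') ⊎ (a ≡ s' × b ≡ s)))
      main = ∈-≈C-pos C≈

      ground-main : Ground S × Ground S'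
      ground-main with main
      ... | _ , _ , m , inj₁ (refl , refl) = Ground-pos-sides θ ground-C m
      ... | _ , _ , m , inj₂ (refl , refl) = swap (Ground-pos-sides θ ground-C m)

      gS : Ground S
      gS = proj₁ ground-main

      gS' : Ground S'
      gS' = proj₂ ground-main

      main-pair : ∃[ m ] (m ∈ nm wC × m ↭ (S ∷ S' ∷ []))
      main-pair with main
      ... | a , b , m , inj₁ (refl , refl) = _ , posPart-∈-nm wC m , ↭-refl
      ... | a , b , m , inj₂ (refl , refl) = _ , posPart-∈-nm wC m , ↭-swap _ _ ↭-refl

      data BelowMain : Literal → Set where
        is-main  : ∀ {a b} → (a ≡ s × b ≡ s') ⊎ (a ≡ s' × b ≡ s) → BelowMain (pos a b)
        pos-below-main : ∀ {a b} → PairBelow (sub θ a) (sub θ b) S S' → BelowMain (pos a b)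
        neg-below-main : ∀ {a b} → S ≻ sub θ a → S ≻ sub θ b → BelowMain (neg a b)

      C-BelowMain : ∀ {L} → L ∈ C → BelowMain L
      C-BelowMain {L} m with ∈-resp-≈C C≈ (Any.map (λ { refl → ↭-refl }) m)
      C-BelowMain {pos a b} m | here p = is-main (↭-pair⁻ p)
      C-BelowMain {neg a b} m | here p = ⊥-elim (pos≉neg (↭-sym p))
      C-BelowMain {L} m | there in-rest with find in-rest
      ... | L' , L'∈ , p with All.lookup smax L'∈
      ...   | ≯ , ≉ = below L m (λ gt → ≯ (≻ms-respˡ-↭ (subL-≈L θ p) gt)) (λ eq → ≉ (↭-trans (↭-sym (subL-≈L θ p)) eq))
        where
        below : ∀ L → L ∈ C → ¬ (subL θ L ≻L subL θ (pos s s')) → ¬ (subL θ L ≈L subL θ (pos s s')) → BelowMain L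
        below (pos a b) m ≯ ≉ with Ground-pos-sides θ ground-C m
        ... | ga , gb = pos-below-main (≯ms⇒PairBelow {S} {S'} gS gS' s≻s' ga gb ≯ ≉)
        below (neg a b) m ≯ _ with Ground-neg-sides θ ground-C m
        ... | ga , gb with ≯ms⇒neg-below {S} {S'} gS gS' s≻s' ga gb ≯
        ...   | S≻a , S≻b = neg-below-main S≻a S≻b

      C-neg-below : NegSidesBelow C θ S
      C-neg-below m with C-BelowMain m | Ground-neg-sides θ ground-C m | NMWitness-Normalizable wC m
      ... | neg-below-main S≻a S≻b | ga , gb | na , nb = (ga , na , S≻a) , (gb , nb , S≻b)

      S≽T : S ≽ T
      S≽T = Subterm⇒≽ gS T⊴s

      C-below-TT' : S ≡ T → T' ≻ S' → All (IsPairBelow T T') (nm wC)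
      C-below-TT' S≡T T'≻S' = All.tabulate below
        where
        double : ∀ {c l} → SideBelow S (sub θ c) → sub θ c ≽ l → IsPairBelow T T' (l ∷ l ∷ [])
        double (_ , _ , S≻c) c≽l = _ , _ , refl , both T≻l T≻l
          where
          T≻l : T ≻ _
          T≻l = subst (_≻ _) S≡T (≻-≽-trans S≻c c≽l)
        below : ∀ {y} → y ∈ nm wC → IsPairBelow T T' y
        below y∈ with ∈-nm⁻ wC y∈
        ... | inj₁ (c , c∈ , M , contrib , y∈M) with InSS⇒SideBelow {C} {θ} {S} C-neg-below c∈
        ...   | side@(gc , _ , _) with All.lookup (SSContrib-bounded gc contrib) y∈M
        ...     | l , refl , c≽l = double {c} side c≽l
        below y∈ | inj₂ (inj₁ (c , c∈ , contrib)) with InTS⇒SideBelow {C} {θ} {S} C-neg-below c∈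
        ... | side@(gc , _ , _) with TSContrib-bounded {θ = θ} {a = c} gc contrib
        ...   | n , refl , c≽n = double {c} side c≽n
        below y∈ | inj₂ (inj₂ (a , b , m , refl)) with C-BelowMain m
        ... | is-main (inj₁ (refl , refl)) = _ , _ , refl , fst S≡T T'≻S'
        ... | is-main (inj₂ (refl , refl)) = _ , _ , refl , snd S≡T T'≻S'
        ... | pos-below-main ab = _ , _ , refl , subst (λ z → PairBelow _ _ z T') S≡T (PairBelow-≽₂ (inj₂ T'≻S') ab)

      D'-pos-below-main : ∀ {a b} → pos a b ∈ D' → PairBelow (sub θ a) (sub θ b) S S'
      D'-pos-below-main m with S≽T
      ... | inj₂ S≻T = PairBelow-≻ T≻T' S≻T (D'-pos-below m)
      ... | inj₁ S≡T with tot gS' gT'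
      ...   | inj₁ S'≡T' = subst₂ (PairBelow _ _) (sym S≡T) (sym S'≡T') (D'-pos-below m)
      ...   | inj₂ (inj₁ S'≻T') = subst (λ z → PairBelow _ _ z S') (sym S≡T)
        (PairBelow-≽₂ (inj₂ S'≻T') (D'-pos-below m))
      ...   | inj₂ (inj₂ T'≻S') = ⊥-elim (PairBelow-all⇒≱nm T≻T' (C-below-TT' S≡T T'≻S') TT'∈nmP C≽P)

      nm-decreases : ∀ E θ* → (∀ {L*} → L* ∈ E → Origin θ* w L*) → ∃[ M ] (NM (E , θ*) M × nm wC ≻nm M)
      nm-decreases E θ* origin =
        nm-below-pair E θ* s≻s' gS E-neg-below E-pos-below (proj₁ (proj₂ main-pair)) (proj₂ (proj₂ main-pair))
        where
        ≡⇒Steps : ∀ {u u'} → u' ≡ u → Steps u u'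
        ≡⇒Steps eq = subst (Steps _) (sym eq) ε

        E-neg-below : NegSidesBelow E θ* S
        E-neg-below m with origin m
        ... | inj₁ (pos _ _ , _ , ())
        ... | inj₁ (neg a b , m' , eq) with neg-injective eq | D'-neg-below m'
        ...   | a≡ , b≡ | sa , sb = SideBelow-≽ S≽T (SideBelow-Steps (≡⇒Steps a≡) sa) ,
                                    SideBelow-≽ S≽T (SideBelow-Steps (≡⇒Steps b≡) sb)
        E-neg-below m | inj₂ (pos _ _ , _ , ())
        E-neg-below m | inj₂ (neg a b , m' , da , db) with C-neg-below m'
        ... | sa , sb = SideBelow-Steps (proj₁ da) sa , SideBelow-Steps (proj₁ db) sb

        E-pos-below : ∀ {a* b*} → pos a* b* ∈ E → PairBelow (sub θ* a*) (sub θ* b*) S S'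
        E-pos-below m with origin m
        ... | inj₁ (neg _ _ , _ , ())
        ... | inj₁ (pos a b , m' , eq) with pos-injective eq
        ...   | a≡ , b≡ = subst₂ (λ x y → PairBelow x y S S') (sym a≡) (sym b≡) (D'-pos-below-main m')
        E-pos-below m | inj₂ (neg _ _ , _ , ())
        E-pos-below m | inj₂ (pos a b , m' , da , db) with C-BelowMain m'
        ... | is-main (inj₁ (refl , refl)) = both (proj₂ da w⊴s) (≻-≽-trans s≻s' (Steps⇒≽ (proj₁ db)))
        ... | is-main (inj₂ (refl , refl)) = both (≻-≽-trans s≻s' (Steps⇒≽ (proj₁ da))) (proj₂ db w⊴s)
        ... | pos-below-main ab = PairBelow-mono s≻s' (Steps⇒≽ (proj₁ da)) (Steps⇒≽ (proj₁ db)) ab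

    open Enumeration Sig _≻_ ro tot T gT using (_≟ₜ_; ss⁻; ts⁻; ss⁻-Enumerates; ts⁻-Enumerates)

    TT : List Term
    TT = T ∷ T ∷ []

    BelowTT : List Term → Set
    BelowTT y = TT ≻ms y

    IsTT : List Term → Set
    IsTT x = x ↭ TT

    IsTT⇒≻ms : ∀ {x y} → IsTT x → BelowTT y → x ≻ms y
    IsTT⇒≻ms x↭ = ≻ms-respˡ-↭ (↭-sym x↭)

    double-BelowTT : ∀ {l} → T ≻ l → BelowTT (l ∷ l ∷ [])
    double-BelowTT T≻l = PairBelow⇒≻ms (both T≻l T≻l)

    D'-posPart-BelowTT : All BelowTT (posPart θ D')
    D'-posPart-BelowTT = All.tabulate below
      where
      below : ∀ {y} → y ∈ posPart θ D' → BelowTT y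
      below y∈ with posPart-∈⁻ D' y∈
      ... | a , b , m , refl = PairBelow⇒≻ms (PairBelow-≽₂ (inj₂ T≻T') (D'-pos-below m))

    SSContrib-BelowTT : ∀ θ* e → SideBelow T (sub θ* e) → ∃[ M ] (SSContrib θ* e M × All BelowTT M)
    SSContrib-BelowTT θ* e (g , n , T≻e) with SSContrib-exists θ* e n
    ... | M , contrib = M , contrib ,
      All.map (λ { (l , refl , e≽l) → double-BelowTT (≻-≽-trans T≻e e≽l) }) (SSContrib-bounded g contrib)

    -- ts⁻-contributions are single pairs; wrapping them as singleton lists lets them share the matching with ss⁻.
    TSContribs : Subst → Term → List (List Term) → Set
    TSContribs θ* a M = ∃[ m ] (TSContrib θ* a m × M ≡ m ∷ [])

    TSContribs-BelowTT : ∀ θ* a → SideBelow T (sub θ* a) → ∃[ M ] (TSContribs θ* a M × All BelowTT M)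
    TSContribs-BelowTT θ* a (g , n , T≻a) with TSContrib-exists θ* a n
    ... | m , contrib with TSContrib-bounded {θ = θ*} {a = a} g contrib
    ...   | _ , refl , a≽n = m ∷ [] , (m , contrib , refl) , double-BelowTT (≻-≽-trans T≻a a≽n) ∷ []

    TSContribs-wrap : ∀ {θ* Ts Ns} → Pointwise (TSContrib θ*) Ts Ns → Pointwise (TSContribs θ*) Ts (map (_∷ []) Ns)
    TSContribs-wrap [] = []
    TSContribs-wrap (c ∷ cs) = (_ , c , refl) ∷ TSContribs-wrap cs

    TSContribs-unwrap : ∀ {θ* Ts Ms} → Pointwise (TSContribs θ*) Ts Ms → Pointwise (TSContrib θ*) Ts (concat Ms)
    TSContribs-unwrap [] = []
    TSContribs-unwrap ((_ , c , refl) ∷ cs) = c ∷ TSContribs-unwrap cs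

    SSMatch : Clause → Subst → Set
    SSMatch E θ* = ∃[ Ms ] (Pointwise (SSContrib θ*) (ss⁻ E) Ms × ∃[ Z ] ∃[ X ] ∃[ Y ]
      (concat (ss-contribs wC) ≈nm Z ++ X × concat Ms ≈nm Z ++ Y × All BelowTT Y × Any IsTT X))

    TSMatch : Clause → Subst → Set
    TSMatch E θ* = ∃[ Ms ] (Pointwise (TSContribs θ*) (ts⁻ E) Ms × ∃[ Z ] ∃[ X ] ∃[ Y ]
      (concat (map (_∷ []) (ts-contribs wC)) ≈nm Z ++ X × concat Ms ≈nm Z ++ Y × All BelowTT Y))

    nm-decreases-by-matching : ∀ E θ* {D B} → SSMatch E θ* → TSMatch E θ* →
      posPart θ* E ≡ D ++ B → All BelowTT D → Decomposition (posPart θ C) B → ∃[ M ] (NM (E , θ*) M × nm wC ≻nm M)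
    nm-decreases-by-matching E θ* {D} {B} (Ms , pw , Z₁ , X₁ , Y₁ , a₁ , b₁ , s₁ , big)
      (Ns , pwT , Z₂ , X₂ , Y₂ , a₂ , b₂ , s₂)
                             posPart≡ smallD dec =
      concat Ms ++ concat Ns ++ posPart θ* E ,
      (_ , _ , _ , _ , ss⁻-Enumerates R E , ts⁻-Enumerates R E , pw , TSContribs-unwrap pwT , refl) ,
      subst (λ P → nm wC ≻nm (concat Ms ++ concat Ns ++ P)) (sym posPart≡)
        (≻nm-combine IsTT⇒≻ms a₁ b₁ s₁ big (subst (_≈nm Z₂ ++ X₂) (List.concat-map-[_] (ts-contribs wC)) a₂) b₂ s₂
          smallD dec)

    module TypeII (x : ℕ) (r : Term) (disjoint : ∀ y → VarOfC y (pos t t' ∷ D') → ¬ VarOfC y C)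
                  (x∈C : VarOfC x C) (θx→r : Repl1 T T' (θ x) r) where
      θ' : Subst
      θ' = update θ x r

      θx→θ'x : Step (θ x) (θ' x)
      θx→θ'x = T , T' , ρ , subst (Repl1 T T' (θ x)) (sym (update-≡ θ x r)) θx→r

      θ→θ' : ∀ y → Steps (θ y) (θ' y)
      θ→θ' y with x ℕ.≟ y
      ... | yes refl = θx→θ'x ◅ ε
      ... | no x≢y = subst (Steps (θ y)) (sym (update-≢ θ x r x≢y)) ε

      θ'-on-D' : ∀ y → VarOfC y D' → θ' y ≡ θ y
      θ'-on-D' y y∈D' with x ℕ.≟ y
      ... | yes refl = ⊥-elim (disjoint x (there y∈D') x∈C)
      ... | no x≢y = update-≢ θ x r x≢y

      sub-D' : ∀ {L e} → L ∈ D' → (∀ {y} → VarOf y e → VarOfL y L) → sub θ' e ≡ sub θ e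
      sub-D' m e⊆L = sub-ext _ λ y v → θ'-on-D' y (Any.map (λ { refl → e⊆L v }) m)

      subL-D' : ∀ {L} → L ∈ D' → subL θ' L ≡ subL θ L
      subL-D' {pos a b} m = cong₂ pos (sub-D' m inj₁) (sub-D' m inj₂)
      subL-D' {neg a b} m = cong₂ neg (sub-D' m inj₁) (sub-D' m inj₂)

      D'-InSS-below : ∀ {e} → InSS D' e → SideBelow T (sub θ' e)
      D'-InSS-below {e} ie@(a , b , m , side) =
        subst (SideBelow T) (sym (sub-D' m (VarOf-side side))) (InSS⇒SideBelow {D'} {θ} {T} D'-neg-below ie)
        where
        VarOf-side : Subterm e a ⊎ Subterm e b → ∀ {y} → VarOf y e → VarOfL y (neg a b)
        VarOf-side (inj₁ q) v = inj₁ (Subterm-trans v q)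
        VarOf-side (inj₂ q) v = inj₂ (Subterm-trans v q)

      origin : ∀ {L*} → L* ∈ D' ++ C → Origin θ' (var x) L*
      origin {L*} m with ∈-++⁻ D' m
      ... | inj₁ m' = inj₁ (L* , m' , subL-D' m')
      ... | inj₂ m' = inj₂ (L* , m' , descends-literal L*)
        where
        descends : ∀ a → Descends θ' (var x) a a
        descends a = sub-Steps θ→θ' a , sub-≻ θ→θ' a (Step⇒≻ θx→θ'x)
        descends-literal : ∀ L → LiteralDescends θ' (var x) L L
        descends-literal (pos a b) = descends a , descends b
        descends-literal (neg a b) = descends a , descends b

      nm-decreases-pos : ∀ s s' rest → sub θ s ≻ sub θ s' → C ≈C (pos s s' ∷ rest) → StrictMaxRest θ (pos s s') rest →
                         Subterm (var x) s → ∃[ M ] (NM (D' ++ C , θ') M × nm wC ≻nm M)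
      nm-decreases-pos s s' rest s≻s' C≈ smax x⊴s =
        PositiveMain.nm-decreases s s' rest s≻s' C≈ smax (var x) x⊴s
          (Subterm-trans (Repl1⇒Subterm θx→r) (Subterm-sub θ x⊴s))
          (D' ++ C) θ' origin

      module Negative (s s' : Term) (rest : Clause) (C≈ : C ≈C (neg s s' ∷ rest)) (x⊴s : Subterm (var x) s) where
        E : Clause
        E = D' ++ C

        x∈ss⁻ : InSS C (var x)
        x∈ss⁻ with ∈-≈C-neg C≈
        ... | a , b , m , inj₁ refl = a , b , m , inj₁ x⊴s
        ... | a , b , m , inj₂ refl = a , b , m , inj₂ x⊴s

        -- xθ may be normalised starting with the step T → T', so its rm_R-contribution contains {T,T}.
        x-contrib-TT : ∀ {c M} → c ≡ var x → SSContrib θ c M → Any IsTT M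
        x-contrib-TT refl (cvar rm) with RM-after-Step rm ρ θx→r
        ... | _ , _ , eq = Any.map ↭-sym (∈-resp-≈ (≈-sym eq) (here ↭-refl))

        module SS = Matching _≟ₜ_ (SSContrib θ) (SSContrib θ') _≡_ (λ p q → trans (sym p) q) BelowTT IsTT
          (_≡ var x) x-contrib-TT

        ss-transfer : ∀ e → SS.Transfer e e
        ss-transfer (var y) M (cvar rm) with x ℕ.≟ y
        ... | yes refl with RM-after-Step rm ρ θx→r
        ...   | M' , rm' , eq =
                M' , TT ∷ [] , cvar (subst (λ z → RM z _ M') (sym (update-≡ θ x r)) rm') ,
                ≈-trans eq (++-comm-≈ (TT ∷ []) M') , λ _ → here ↭-refl
        ss-transfer (var y) M (cvar rm) | no x≢y =
          M , [] , cvar (subst (λ z → RM z _ M) (sym (update-≢ θ x r x≢y)) rm) , ≈-++-[] M ,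
            λ { refl → ⊥-elim (x≢y refl) }
        ss-transfer (fun f es) M (cfun nfs rm) =
          M , [] , cfun (VecPW.map (λ {a} → NF-after-Steps (sub-Steps θ→θ' a)) nfs) rm , ≈-++-[] M , λ ()

        ss-choice : ∀ e → e ∈ ss⁻ E → SS.Choice (ss-list wC) e
        ss-choice e m with proj₁ (proj₂ (ss⁻-Enumerates R E)) e m
        ... | a , b , m' , side with ∈-++⁻ D' m'
        ...   | inj₁ mD = inj₂ (SSContrib-BelowTT θ' e (D'-InSS-below (a , b , mD , side)))
        ...   | inj₂ mC = inj₁ (e , proj₂ (proj₂ (ss-enum wC)) e (a , b , mC , side) , refl , ss-transfer e)

        module TS = Matching _≟ₜ_ (TSContribs θ) (TSContribs θ') _≡_ (λ p q → trans (sym p) q) BelowTT IsTT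
          (λ _ → ⊥) (λ ())

        ts-transfer : ∀ e → TS.Transfer e e
        ts-transfer e M (m , (n , nf , refl) , refl) =
          M , [] , (m , (n , NF-after-Steps (sub-Steps θ→θ' e) nf , refl) , refl) , ≈-++-[] M , λ ()

        ts-choice : ∀ e → e ∈ ts⁻ E → TS.Choice (ts-list wC) e
        ts-choice e m with proj₁ (proj₂ (ts⁻-Enumerates R E)) e m
        ... | a , b , m' , side with ∈-++⁻ D' m'
        ...   | inj₁ mD = inj₂ (TSContribs-BelowTT θ' e (D'-InSS-below (InTS⇒InSS (a , b , mD , side))))
        ...   | inj₂ mC = inj₁ (e , proj₂ (proj₂ (ts-enum wC)) e (a , b , mC , side) , refl , ts-transfer e)

        posPart≡ : posPart θ' E ≡ posPart θ D' ++ posPart θ' C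
        posPart≡ = trans (posPart-++ θ' D' C) (cong (_++ posPart θ' C) (posPart-ext D' θ'-on-D'))

        posPart-≽ : ∀ A → Pointwise (λ m m' → m ≡ m' ⊎ m ≻ms m') (posPart θ A) (posPart θ' A)
        posPart-≽ [] = []
        posPart-≽ (pos a b ∷ A) = ≽-pair⇒≡⊎≻ms (Steps⇒≽ (sub-Steps θ→θ' a)) (Steps⇒≽ (sub-Steps θ→θ' b)) ∷ posPart-≽ A
        posPart-≽ (neg a b ∷ A) = posPart-≽ A

        nm-decreases-neg : ∃[ M ] (NM (E , θ') M × nm wC ≻nm M)
        nm-decreases-neg
          with SS.match (ss-list wC) (ss-contribs wC) (ss-pw wC) (ss⁻ E) (proj₁ (ss⁻-Enumerates R E)) ss-choice
             | TS.match (ts-list wC) (map (_∷ []) (ts-contribs wC)) (TSContribs-wrap (ts-pw wC)) (ts⁻ E)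
               (proj₁ (ts⁻-Enumerates R E)) ts-choice
        ... | Ms , pw , Z , X , Y , a , b , small , marked | Ns , pwT , Z' , X' , Y' , a' , b' , small' , _ =
          nm-decreases-by-matching E θ'
            (Ms , pw , Z , X , Y , a , b , small , marked refl (proj₂ (proj₂ (ss-enum wC)) (var x) x∈ss⁻))
            (Ns , pwT , Z' , X' , Y' , a' , b' , small')
            posPart≡ D'-posPart-BelowTT (Pointwise-≽⇒Decomposition (posPart-≽ C))

    module TypeI (u : Term) (σ : Subst) (C' : Clause) (disjoint : ∀ y → VarOfC y (pos t t' ∷ D') → ¬ VarOfC y C)
                 (u-nonvar : ¬ IsVar u) (T≡uθ : T ≡ sub θ u) (mgu : IsMGU σ t u) (C→C' : ReplAllC u t' C C') where

      -- θ unifies t and u, hence θ = τσ for some τ, and idempotence of σ gives θσ = θ.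
      θσ≡θ : ∀ x → sub θ (σ x) ≡ θ x
      θσ≡θ x with proj₁ (proj₂ mgu) θ T≡uθ
      ... | τ , θ≡τσ = begin
        sub θ (σ x)         ≡⟨ sub-ext (σ x) (λ z _ → θ≡τσ z) ⟩
        sub (τ ∘ₛ σ) (σ x)  ≡⟨ sym (sub-∘ τ σ (σ x)) ⟩
        sub τ (sub σ (σ x)) ≡⟨ cong (sub τ) (proj₂ (proj₂ mgu) x) ⟩
        sub τ (σ x)         ≡⟨ sym (θ≡τσ x) ⟩
        θ x                 ∎
        where open ≡-Reasoning

      sub-θσ : ∀ w → sub θ (sub σ w) ≡ sub θ w
      sub-θσ w = trans (sub-∘ θ σ w) (sub-ext w (λ x _ → θσ≡θ x))

      subL-θσ : ∀ L → subL θ (subL σ L) ≡ subL θ L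
      subL-θσ (pos a b) = cong₂ pos (sub-θσ a) (sub-θσ b)
      subL-θσ (neg a b) = cong₂ neg (sub-θσ a) (sub-θσ b)

      ρu : R (sub θ u) T'
      ρu = subst (λ z → R z T') T≡uθ ρ

      -- Remapping a variable outside t and u yields another unifier, which factors through σ only if σ maps
      -- that variable to a variable.
      σ-nonvar⇒VarOf : ∀ y → ¬ IsVar (σ y) → VarOf y t ⊎ VarOf y u
      σ-nonvar⇒VarOf y σy-nonvar with VarOf? y t | VarOf? y u
      ... | yes y∈t | _ = inj₁ y∈t
      ... | no _ | yes y∈u = inj₂ y∈u
      ... | no y∉t | no y∉u with proj₁ (proj₂ mgu) σ[y≔0] unifies
        where
        σ[y≔0] : Subst
        σ[y≔0] = update σ y (var 0)
        agrees : ∀ w → ¬ VarOf y w → sub σ[y≔0] w ≡ sub σ w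
        agrees w y∉w = sub-ext w λ z v → update-≢ σ y (var 0) λ { refl → y∉w v }
        unifies : sub σ[y≔0] t ≡ sub σ[y≔0] u
        unifies = trans (agrees t y∉t) (trans (proj₁ mgu) (sym (agrees u y∉u)))
      ...   | τ , factor with σ y | factor y
      ...     | var z | _ = ⊥-elim (σy-nonvar (z , refl))
      ...     | fun f ws | eq = ⊥-elim (var≢fun (trans (sym (update-≡ σ y (var 0))) eq))

      VarOf⇒⊴T : ∀ {y} → VarOf y t ⊎ VarOf y u → Subterm (θ y) T
      VarOf⇒⊴T (inj₁ y∈t) = Subterm-sub θ y∈t
      VarOf⇒⊴T (inj₂ y∈u) = subst (Subterm _) (sym T≡uθ) (Subterm-sub θ y∈u)

      ProperSubterm-σ⇒≺T : ∀ {e y} → ProperSubterm e (σ y) → T ≻ sub θ e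
      ProperSubterm-σ⇒≺T {e} {y} pr =
        ProperSubterm⇒≻ gT
          (ProperSubterm-Subterm-trans (subst (ProperSubterm (sub θ e)) (θσ≡θ y) (ProperSubterm-sub θ pr))
                                                       (VarOf⇒⊴T (σ-nonvar⇒VarOf y σy-nonvar)))
        where
        σy-nonvar : ¬ IsVar (σ y)
        σy-nonvar (z , eq) with subst (ProperSubterm e) eq pr
        ... | ()

      VarOf-u⇒≺T : ∀ {y} → VarOf y u → T ≻ θ y
      VarOf-u⇒≺T {y} y∈u with ¬IsVar⇒fun u u-nonvar
      ... | f , us , refl with y∈u
      ...   | arg i q = subst (_≻ θ y) (sym T≡uθ)
        (ProperSubterm⇒≻ (subst Ground T≡uθ gT) (ProperSubterm-sub θ (arg i q)))

      E : Clause
      E = subC σ (D' ++ C')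

      ∈C'⁻ : ∀ {L} → L ∈ C' → ∃[ L₁ ] (L₁ ∈ C × ReplAllL u t' L₁ L)
      ∈C'⁻ = Pointwise-∈ʳ C→C'

      ReplAll-Stepsθσ : ∀ {a a*} → ReplAll u t' a a* → Steps (sub θ a) (sub θ (sub σ a*))
      ReplAll-Stepsθσ {a* = a*} r = subst (Steps _) (sym (sub-θσ a*)) (ReplAll-Steps ρu r)

      ReplAll-Descends : ∀ {a a*} → ReplAll u t' a a* → Descends θ u a (sub σ a*)
      ReplAll-Descends {a* = a*} r = ReplAll-Stepsθσ r , λ u⊴a → subst (_ ≻_) (sym (sub-θσ a*)) (ReplAll-≻ ρu r u⊴a)

      descends-literal : ∀ {L₁ L} → ReplAllL u t' L₁ L → LiteralDescends θ u L₁ (subL σ L)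
      descends-literal {pos _ _} {pos _ _} (ra , rb) = ReplAll-Descends ra , ReplAll-Descends rb
      descends-literal {neg _ _} {neg _ _} (ra , rb) = ReplAll-Descends ra , ReplAll-Descends rb

      origin : ∀ {L*} → L* ∈ E → Origin θ u L*
      origin m with ∈-map⁻ (subL σ) m
      ... | L , m' , refl with ∈-++⁻ D' m'
      ...   | inj₁ mD = inj₁ (L , mD , subL-θσ L)
      ...   | inj₂ mC' with ∈C'⁻ mC'
      ...     | L₁ , m₁ , r = inj₂ (L₁ , m₁ , descends-literal r)

      nm-decreases-pos : ∀ s s' rest → sub θ s ≻ sub θ s' → C ≈C (pos s s' ∷ rest) → StrictMaxRest θ (pos s s') rest →
                         Subterm u s → ∃[ M ] (NM (E , θ) M × nm wC ≻nm M)
      nm-decreases-pos s s' rest s≻s' C≈ smax u⊴s =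
        PositiveMain.nm-decreases s s' rest s≻s' C≈ smax u u⊴s
          (subst (λ z → Subterm z (sub θ s)) (sym T≡uθ) (Subterm-sub θ u⊴s))
          E θ origin

      GroundNormalizable : Term → Set
      GroundNormalizable v = Ground v × Normalizable v

      E-neg-sides : ∀ {a* b*} → neg a* b* ∈ E → GroundNormalizable (sub θ a*) × GroundNormalizable (sub θ b*)
      E-neg-sides m with ∈-map⁻ (subL σ) m
      ... | pos _ _ , _ , ()
      ... | neg a b , m' , refl with ∈-++⁻ D' m'
      ...   | inj₁ mD with D'-neg-below mD
      ...     | (ga , na , _) , (gb , nb , _) =
                subst GroundNormalizable (sym (sub-θσ a)) (ga , na) ,
                  subst GroundNormalizable (sym (sub-θσ b)) (gb , nb)
      E-neg-sides m | neg a b , m' , refl | inj₂ mC' with ∈C'⁻ mC'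
      ... | pos _ _ , _ , ()
      ... | neg a₁ b₁ , m₁ , ra ,
        rb = along ra (proj₁ (Ground-neg-sides θ ground-C m₁)) (proj₁ (NMWitness-Normalizable wC m₁)) ,
                                       along rb (proj₂ (Ground-neg-sides θ ground-C m₁))
                                         (proj₂ (NMWitness-Normalizable wC m₁))
        where
        along : ∀ {c c*} → ReplAll u t' c c* → Ground (sub θ c) → Normalizable (sub θ c) →
            GroundNormalizable (sub θ (sub σ c*))
        along r g (n , _ , rm) = Steps-Ground (ReplAll-Stepsθσ r) g , n , RM-after-Steps (ReplAll-Stepsθσ r) rm

      InSS-E⇒GroundNormalizable : ∀ {e} → InSS E e → GroundNormalizable (sub θ e)
      InSS-E⇒GroundNormalizable (a , b , m , side) = in-side side (E-neg-sides m)
        where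
        in-side : ∀ {e} → Subterm e a ⊎ Subterm e b →
            GroundNormalizable (sub θ a) × GroundNormalizable (sub θ b) → GroundNormalizable (sub θ e)
        in-side (inj₁ q) ((g , _ , _ , rm) , _) = Ground-Subterm g (Subterm-sub θ q) ,
          Normalizable-Subterm rm (Subterm-sub θ q)
        in-side (inj₂ q) (_ , (g , _ , _ , rm)) = Ground-Subterm g (Subterm-sub θ q) ,
          Normalizable-Subterm rm (Subterm-sub θ q)

      InTS-E⇒GroundNormalizable : ∀ {e} → InTS E e → GroundNormalizable (sub θ e)
      InTS-E⇒GroundNormalizable (a , b , m , inj₁ refl) = proj₁ (E-neg-sides m)
      InTS-E⇒GroundNormalizable (a , b , m , inj₂ refl) = proj₂ (E-neg-sides m)

      Image : Term → Term → Set
      Image c e = ∃[ c' ] (ReplAll u t' c c' × e ≡ sub σ c')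

      Image-functional : ∀ {c e e'} → Image c e → Image c e' → e ≡ e'
      Image-functional (_ , r₁ , refl) (_ , r₂ , refl) = cong (sub σ) (ReplAll-functional r₁ r₂)

      args-NF-after-ReplAll : ∀ {n} {cs cs' ns : Vec Term n} → VecPW.Pointwise (λ a m → NF (sub θ a) m) cs ns →
        ReplAlls u t' cs cs' → VecPW.Pointwise (λ a m → NF (sub θ a) m) (subs σ cs') ns
      args-NF-after-ReplAll VecPW.[] [] = VecPW.[]
      args-NF-after-ReplAll (nf VecPW.∷ nfs) (r ∷ rs) = NF-after-Steps (ReplAll-Stepsθσ r) nf VecPW.∷
        args-NF-after-ReplAll nfs rs

      -- The arguments of uθ = T are proper subterms of a left-hand side, hence irreducible, so the
      -- normalisation of uθ in nm_R starts with the rule T → T' at the top.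
      u-contrib-TT : ∀ {c M} → c ≡ u → SSContrib θ c M → Any IsTT M
      u-contrib-TT refl contrib with ¬IsVar⇒fun u u-nonvar
      ... | f , us , refl with contrib
      ...   | cfun nfs rm with NF-Irreducible-args (args-NF-subs nfs)
        (λ i → Irreducible-ProperSubterm-lhs ρu (arg i top))
      ...     | refl with RM-after-Step rm ρu here
      ...       | _ , _ ,
        eq = Any.map (λ p → subst (λ z → _ ↭ (z ∷ z ∷ [])) (sym T≡uθ) (↭-sym p)) (∈-resp-≈ (≈-sym eq) (here ↭-refl))

      module Negative (s s' : Term) (rest : Clause) (C≈ : C ≈C (neg s s' ∷ rest)) (u⊴s : Subterm u s) where
        u∈ss⁻ : InSS C u
        u∈ss⁻ with ∈-≈C-neg C≈
        ... | a , b , m , inj₁ refl = a , b , m , inj₁ u⊴s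
        ... | a , b , m , inj₂ refl = a , b , m , inj₂ u⊴s

        module SS = Matching _≟ₜ_ (SSContrib θ) (SSContrib θ) Image Image-functional BelowTT IsTT (_≡ u) u-contrib-TT

        ss-unchanged : ∀ {c e} → c ≢ u → (∀ {M} → SSContrib θ c M → SSContrib θ e M) → SS.Transfer c e
        ss-unchanged c≢u same M contrib = M , [] , same contrib , ≈-++-[] M , λ c≡u → ⊥-elim (c≢u c≡u)

        ss-small : ∀ {e} → InSS E e → T ≻ sub θ e → SS.Choice (ss-list wC) e
        ss-small {e} ie T≻e with InSS-E⇒GroundNormalizable ie
        ... | g , n = inj₂ (SSContrib-BelowTT θ e (g , n , T≻e))

        ss-image : ∀ {c v} → InSS C c → ReplAll u t' c v → c ≢ u → InSS E (sub σ v) → SS.Choice (ss-list wC) (sub σ v)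
        ss-image _ hit c≢u _ = ⊥-elim (c≢u refl)
        ss-image {var y} c∈@(_ , _ , m , side) (varR u≢y) c≢u ie with σ y in σy≡
        ... | var z = inj₁ (var y , proj₂ (proj₂ (ss-enum wC)) _ c∈ , (var y , varR u≢y , sym σy≡) ,
                            ss-unchanged c≢u λ
                              { (cvar rm) →
                                cvar (subst (λ w → RM w _ _) (trans (sym (θσ≡θ y)) (cong (sub θ) σy≡)) rm) })
        ... | fun f ws = ss-small ie
                           (subst (T ≻_) (sym (trans (cong (sub θ) (sym σy≡)) (θσ≡θ y))) (VarOf-u⇒≺T y∈u))
          where
          y∈u : VarOf y u
          y∈u with σ-nonvar⇒VarOf y (λ { (z , σy≡z) → var≢fun (trans (sym σy≡z) σy≡) })
          ... | inj₁ y∈t = ⊥-elim (disjoint y (here (inj₁ y∈t)) (Any.map (λ { refl → side }) m))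
          ... | inj₂ y∈u' = y∈u'
        ss-image {fun f cs} c∈ (funR u≢c rcs) c≢u _ =
          inj₁ (fun f cs , proj₂ (proj₂ (ss-enum wC)) _ c∈ , (_ , funR u≢c rcs , refl) ,
                ss-unchanged c≢u λ { (cfun nfs rm) → cfun (args-NF-after-ReplAll nfs rcs) rm })

        SideChoice : Term → Set
        SideChoice w = ∀ {v} → Subterm v w → InSS E (sub σ v) → SS.Choice (ss-list wC) (sub σ v)

        D'-side-choice : ∀ {a b} → neg a b ∈ D' → SideChoice a × SideChoice b
        D'-side-choice {a} {b} m = below inj₁ , below inj₂
          where
          below : ∀ {w} → (∀ {v} → Subterm v w → Subterm v a ⊎ Subterm v b) → SideChoice w
          below {w} side {v} v⊴w ie = ss-small ie (subst (T ≻_) (sym (sub-θσ v))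
            (proj₂ (proj₂ (InSS⇒SideBelow {D'} {θ} {T} D'-neg-below (a , b , m , side v⊴w)))))

        C'-side-choice : ∀ {w₁ w} → (∀ {c} → Subterm c w₁ → InSS C c) → ReplAll u t' w₁ w → SideChoice w
        C'-side-choice in-C r {v} v⊴w ie with Subterm-of-ReplAll r v⊴w
        ... | inj₁ v⊴t' = ss-small ie
          (subst (T ≻_) (sym (sub-θσ v)) (≻-≽-trans T≻T' (Subterm⇒≽ gT' (Subterm-sub θ v⊴t'))))
        ... | inj₂ (c , c⊴w₁ , rc , c≢u) = ss-image (in-C c⊴w₁) rc c≢u ie

        side-choices : ∀ {a b} → neg a b ∈ D' ++ C' → SideChoice a × SideChoice b
        side-choices m with ∈-++⁻ D' m
        ... | inj₁ mD = D'-side-choice mD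
        ... | inj₂ mC' with ∈C'⁻ mC'
        ...   | pos _ _ , _ , ()
        ...   | neg a₁ b₁ , m₁ , ra , rb =
                C'-side-choice (λ q → a₁ , b₁ , m₁ , inj₁ q) ra , C'-side-choice (λ q → a₁ , b₁ , m₁ , inj₂ q) rb

        from-side : ∀ {e w} → Subterm e (sub σ w) → SideChoice w → InSS E e → SS.Choice (ss-list wC) e
        from-side {w = w} q choice ie with Subterm-of-sub σ w q
        ... | inj₁ (v , v⊴w , refl) = choice v⊴w ie
        ... | inj₂ (y , _ , pr) = ss-small ie (ProperSubterm-σ⇒≺T pr)

        ss-choice : ∀ e → e ∈ ss⁻ E → SS.Choice (ss-list wC) e
        ss-choice e e∈ with proj₁ (proj₂ (ss⁻-Enumerates R E)) e e∈
        ... | ie@(_ , _ , m* , side) with ∈-map⁻ (subL σ) m*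
        ...   | pos _ _ , _ , ()
        ...   | neg a b , m , refl with side
        ...     | inj₁ q = from-side q (proj₁ (side-choices m)) ie
        ...     | inj₂ q = from-side q (proj₂ (side-choices m)) ie

        module TS = Matching _≟ₜ_ (TSContribs θ) (TSContribs θ) Image Image-functional BelowTT IsTT (λ _ → ⊥) (λ ())

        ts-transfer : ∀ {a₁ a} → ReplAll u t' a₁ a → TS.Transfer a₁ (sub σ a)
        ts-transfer r M (m , (n , nf , refl) , refl) =
          M , [] , (m , (n , NF-after-Steps (ReplAll-Stepsθσ r) nf , refl) , refl) , ≈-++-[] M , λ ()

        ts-small : ∀ {e} → InTS E e → T ≻ sub θ e → TS.Choice (ts-list wC) e
        ts-small {e} ie T≻e with InTS-E⇒GroundNormalizable ie
        ... | g , n = inj₂ (TSContribs-BelowTT θ e (g , n , T≻e))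

        ts-choice : ∀ e → e ∈ ts⁻ E → TS.Choice (ts-list wC) e
        ts-choice e e∈ with proj₁ (proj₂ (ts⁻-Enumerates R E)) e e∈
        ... | ie@(_ , _ , m* , side) with ∈-map⁻ (subL σ) m*
        ...   | pos _ _ , _ , ()
        ...   | neg a b , m , refl with ∈-++⁻ D' m | side
        ...     | inj₁ mD | inj₁ refl = ts-small ie
          (subst (T ≻_) (sym (sub-θσ a)) (proj₂ (proj₂ (proj₁ (D'-neg-below mD)))))
        ...     | inj₁ mD | inj₂ refl = ts-small ie
          (subst (T ≻_) (sym (sub-θσ b)) (proj₂ (proj₂ (proj₂ (D'-neg-below mD)))))
        ...     | inj₂ mC' | _ with ∈C'⁻ mC'
        ...       | pos _ _ , _ , ()
        ...       | neg a₁ b₁ , m₁ , ra , rb with side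
        ...         | inj₁ refl = inj₁
          (a₁ , proj₂ (proj₂ (ts-enum wC)) a₁ (a₁ , b₁ , m₁ , inj₁ refl) , (a , ra , refl) , ts-transfer ra)
        ...         | inj₂ refl = inj₁
          (b₁ , proj₂ (proj₂ (ts-enum wC)) b₁ (a₁ , b₁ , m₁ , inj₂ refl) , (b , rb , refl) , ts-transfer rb)

        posPart≡ : posPart θ E ≡ posPart θ D' ++ posPart θ C'
        posPart≡ = trans (posPart-subC θ σ (D' ++ C'))
          (trans (posPart-ext (D' ++ C') (λ x _ → θσ≡θ x)) (posPart-++ θ D' C'))

        posPart-≽ : ∀ {A A'} → Pointwise (ReplAllL u t') A A' →
            Pointwise (λ m m' → m ≡ m' ⊎ m ≻ms m') (posPart θ A) (posPart θ A')
        posPart-≽ [] = []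
        posPart-≽ (_∷_ {x = pos _ _} {y = pos _ _} (ra , rb) rs) =
          ≽-pair⇒≡⊎≻ms (Steps⇒≽ (ReplAll-Steps ρu ra)) (Steps⇒≽ (ReplAll-Steps ρu rb)) ∷ posPart-≽ rs
        posPart-≽ (_∷_ {x = neg _ _} {y = neg _ _} _ rs) = posPart-≽ rs
        posPart-≽ (_∷_ {x = pos _ _} {y = neg _ _} () _)
        posPart-≽ (_∷_ {x = neg _ _} {y = pos _ _} () _)

        nm-decreases-neg : ∃[ M ] (NM (E , θ) M × nm wC ≻nm M)
        nm-decreases-neg
          with SS.match (ss-list wC) (ss-contribs wC) (ss-pw wC) (ss⁻ E) (proj₁ (ss⁻-Enumerates R E)) ss-choice
             | TS.match (ts-list wC) (map (_∷ []) (ts-contribs wC)) (TSContribs-wrap (ts-pw wC)) (ts⁻ E)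
               (proj₁ (ts⁻-Enumerates R E)) ts-choice
        ... | Ms , pw , Z , X , Y , a , b , small , marked | Ns , pwT , Z' , X' , Y' , a' , b' , small' , _ =
          nm-decreases-by-matching E θ
            (Ms , pw , Z , X , Y , a , b , small , marked refl (proj₂ (proj₂ (ss-enum wC)) u u∈ss⁻))
            (Ns , pwT , Z' , X' , Y' , a' , b' , small')
            posPart≡ D'-posPart-BelowTT (Pointwise-≽⇒Decomposition (posPart-≽ C→C'))

  ParSup-nm-decreases : ∀ {D' t t' C θ concl} → Inference.ParSup _≻_ D' t t' C θ concl →
    (wC : NMWitness C θ) (wP : NMWitness (pos t t' ∷ D') θ) → nm wC ≻nm nm wP ⊎ nm wC ≈nm nm wP →
    R (sub θ t) (sub θ t') → ∃[ M ] (NM concl M × nm wC ≻nm M)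
  ParSup-nm-decreases {D'} {t} {t'} {C} {θ}
    (Inference.typeI u σ C' disjoint gP gC u-nonvar T≡uθ mgu C→C' _ (s , s' , rest , u⊴s , s≻s' , main) left) wC
      wP C≽P ρ
    with main
  ... | inj₁ (C≈ , smax) = TypeI.nm-decreases-pos u σ C' disjoint u-nonvar T≡uθ mgu C→C' s s' rest s≻s' C≈ smax u⊴s
    where open Premises D' t t' C θ gP gC left ρ wC wP C≽P
  ... | inj₂ (C≈ , _) = TypeI.Negative.nm-decreases-neg u σ C' disjoint u-nonvar T≡uθ mgu C→C' s s' rest C≈ u⊴s
    where open Premises D' t t' C θ gP gC left ρ wC wP C≽P
  ParSup-nm-decreases {D'} {t} {t'} {C} {θ}
    (Inference.typeII x r disjoint gP gC x∈C θx→r _ (s , s' , rest , x⊴s , s≻s' , main) left) wC wP C≽P ρ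
    with main
  ... | inj₁ (C≈ , smax) = TypeII.nm-decreases-pos x r disjoint x∈C θx→r s s' rest s≻s' C≈ smax x⊴s
    where open Premises D' t t' C θ gP gC left ρ wC wP C≽P
  ... | inj₂ (C≈ , _) = TypeII.Negative.nm-decreases-neg x r disjoint x∈C θx→r s s' rest C≈ x⊴s
    where open Premises D' t t' C θ gP gC left ρ wC wP C≽P

  ParSup-NM-decreases : ∀ {D' t t' C θ concl M₁ M₂} → Inference.ParSup _≻_ D' t t' C θ concl →
    NM (C , θ) M₁ → NM (pos t t' ∷ D' , θ) M₂ → M₁ ≻nm M₂ ⊎ M₁ ≈nm M₂ →
    R (sub θ t) (sub θ t') → ∃[ M ] (NM concl M × M₁ ≻nm M)
  ParSup-NM-decreases inference nmC nmP C≽P ρ with NM⇒NMWitness nmC | NM⇒NMWitness nmP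
  ... | wC , refl | wP , refl = ParSup-nm-decreases inference wC wP C≽P ρ

lemma15 : (Sig : Signature) →
    let open Fol Sig in
    (_≻_ : Term → Term → Set) → IsReductionOrdering _≻_ → TotalOnGround _≻_ →
    (R : Term → Term → Set) → Rewriting.GroundRS R → Rewriting.LeftReduced R →
    Rewriting.ContainedIn R _≻_ →
    (_≻Clo_ : Closure → Closure → Set) → IsClosureOrdering _≻Clo_ →
    (D' : Clause) (t t' : Term) (C : Clause) (θ : Subst) (concl : Closure) →
    Inference.ParSup _≻_ D' t t' C θ concl →
    ClosureOrder._≺≺_ _≻_ R _≻Clo_ (pos t t' ∷ D' , θ) (C , θ) →
    R (sub θ t) (sub θ t') →
    ClosureOrder._≻≻_ _≻_ R _≻Clo_ (C , θ) concl
lemma15 Sig _≻_ ro tot R grs lr cont _ _ D' t t' C θ concl inference (_ , _ , nmC , nmP , C≽P) ρ =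
  let M , nmConcl , decrease = ParSup-NM-decreases inference nmC nmP (map₂ proj₁ C≽P) ρ
  in _ , M , nmC , nmConcl , inj₁ decrease
  where open Inferences Sig _≻_ ro tot R grs lr cont
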